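{- Let $t,e\in\mathbb{N}$ and let $r$ be an odd prime with $\gcd(t,r)=1$. Let $Q_e$ be the set of squares modulo $r^e$ and $\mathcal{S}_e:=\{x\in\mathbb{Z}/r^e\mathbb{Z}: x^2-t\in Q_e\}$. Let $\bar t:=4^{ -1}t \bmod r^e$. Then $|\mathcal{S}_1|=(r+(\bar t\,|\,r))/2$ and \[ |\mathcal{S}_{e+1}|=\begin{cases}|\mathcal{S}_e|\cdot r & \text{if } (\bar t\,|\,r)=-1,\\ |\mathcal{S}_e|\cdot r-2^{\,e\bmod 2}\cdot(r-1) & \text{if } (\bar t\,|\,r)=1,\end{cases} \] i.e. in the second case one subtracts $2(r-1)$ when $e$ is odd and $r-1$ when $e$ is even.
   Context: $(\cdot|\cdot)$ denotes the Legendre symbol. $Q_e=\{y^2\bmod r^e: y\in\mathbb{Z}\}$. -}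

module Defs where

open import Data.Nat as ℕ using (ℕ; _^_; _<_)
open import Data.Nat.Divisibility as ℕD using ()
open import Data.Integer as ℤ using (ℤ; +_; _-_; _*_; ∣_∣; 0ℤ; 1ℤ; -1ℤ)
open import Data.Integer.Divisibility using (_∣_)
open import Data.List using (List; upTo; filter; length)
open import Data.List.Relation.Unary.Any using (Any; any?)
open import Relation.Nullary using (Dec; yes; no)
open import Relation.Unary using (Decidable)
open import Data.Product using (Σ; _×_)

_≡_[mod_] : ℤ → ℤ → ℕ → Set
a ≡ b [mod m ] = (+ m) ∣ (a - b)

_≡?_[mod_] : (a b : ℤ) (m : ℕ) → Dec (a ≡ b [mod m ])
a ≡? b [mod m ] = m ℕD.∣? ∣ a - b ∣

-- Residues of ℤ/mℤ are represented by the naturals 0 , … , m-1  (the list  upTo m).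

IsSquareMod : ℕ → ℤ → Set
IsSquareMod m z = Any (λ y → (+ y * + y) ≡ z [mod m ]) (upTo m)

isSquareMod? : (m : ℕ) → Decidable (IsSquareMod m)
isSquareMod? m z = any? (λ y → (+ y * + y) ≡? z [mod m ]) (upTo m)

Q : ℕ → ℕ → ℤ → Set
Q r e = IsSquareMod (r ^ e)

InS : ℕ → ℕ → ℕ → ℕ → Set
InS t r e x = Q r e ((+ x * + x) - + t)

inS? : (t r e : ℕ) → Decidable (InS t r e)
inS? t r e x = isSquareMod? (r ^ e) ((+ x * + x) - + t)

S : ℕ → ℕ → ℕ → List ℕ
S t r e = filter (inS? t r e) (upTo (r ^ e))

card-S : ℕ → ℕ → ℕ → ℕ
card-S t r e = length (S t r e)

legendre : ℤ → ℕ → ℤ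
legendre a p with a ≡? 0ℤ [mod p ]
... | yes _ = 0ℤ
... | no _ with isSquareMod? p a
...   | yes _ = 1ℤ
...   | no _ = -1ℤ

-- Write a residue modulo r^(e+1) as x = k r^e + a with a a residue modulo r^e and k < r.
-- If a ∈ 𝒮_e and a² ≢ t (mod r^e), then x² − t ≡ a² − t is a square modulo r^e that r^e does not
-- divide, so by Hensel's lemma (r is odd) it is a square modulo r^(e+1): all r lifts of a lie in 𝒮_(e+1).
-- If a² − t = c r^e, then x² − t ≡ r^e (c + 2ak) (mod r^(e+1)), and k ↦ c + 2ak permutes ℤ/r because
-- r ∤ 2a. Hence such a root a has exactly one lift that is again a root, and exactly
-- P_e = #{ j mod r : r^e j is a square mod r^(e+1) } lifts in 𝒮_(e+1). The number of roots therefore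
-- stays 1 + (t|r) = 1 + (t̄|r), and |𝒮_(e+1)| + (1 + (t̄|r)) r = r |𝒮_e| + (1 + (t̄|r)) P_e.
-- Dividing out r² shows P_(e+2) = P_e, so P_e = (r + 1)/2 for even e and P_e = 1 for odd e.
-- The base case counts the points of the conic y² = x² − t modulo r, of which there are r − 1.

module Submission where

open import Data.Nat using (ℕ)
open import Data.Nat.Primality using (Prime)
open import Data.Nat.Coprimality using (Coprime)
open import Relation.Binary.PropositionalEquality using (_≢_)

module Counting where

  open import Data.Nat using (ℕ; zero; suc; _+_; _*_; _<_; _≟_; s≤s⁻¹)
  open import Data.Nat.Properties
  open import Algebra.Properties.CommutativeSemigroup +-commutativeSemigroup using (interchange)
  open import Data.List using ([]; _∷_; filter; upTo; length; _++_)
  import Data.List.Properties as List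
  open import Data.Sum using (_⊎_; [_,_]′)
  open import Data.Empty using (⊥-elim)
  open import Function using (_∘_; id)
  open import Function.Bundles using (_⇔_; Equivalence)
  open import Relation.Nullary using (Dec; yes; no; ¬_)
  open import Relation.Unary using (Decidable)
  open import Relation.Binary.PropositionalEquality
  open ≡-Reasoning

  ∑< : ℕ → (ℕ → ℕ) → ℕ
  ∑< zero    f = 0
  ∑< (suc n) f = ∑< n f + f n

  ∑<-cong : ∀ n {f g : ℕ → ℕ} → (∀ k → k < n → f k ≡ g k) → ∑< n f ≡ ∑< n g
  ∑<-cong zero    f≗g = refl
  ∑<-cong (suc n) f≗g = cong₂ _+_ (∑<-cong n (λ k k<n → f≗g k (m<n⇒m<1+n k<n))) (f≗g n ≤-refl)

  ∑<-const : ∀ n c → ∑< n (λ _ → c) ≡ n * c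
  ∑<-const zero    c = refl
  ∑<-const (suc n) c = trans (cong (_+ c) (∑<-const n c)) (+-comm (n * c) c)

  ∑<-zero : ∀ n {f : ℕ → ℕ} → (∀ k → k < n → f k ≡ 0) → ∑< n f ≡ 0
  ∑<-zero n f≗0 = trans (∑<-cong n f≗0) (trans (∑<-const n 0) (*-zeroʳ n))

  ∑<-distrib-+ : ∀ n (f g : ℕ → ℕ) → ∑< n (λ k → f k + g k) ≡ ∑< n f + ∑< n g
  ∑<-distrib-+ zero    f g = refl
  ∑<-distrib-+ (suc n) f g =
    trans (cong (_+ (f n + g n)) (∑<-distrib-+ n f g)) (interchange (∑< n f) (∑< n g) (f n) (g n))

  ∑<-distribˡ-* : ∀ n c (f : ℕ → ℕ) → ∑< n (λ k → c * f k) ≡ c * ∑< n f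
  ∑<-distribˡ-* zero    c f = sym (*-zeroʳ c)
  ∑<-distribˡ-* (suc n) c f =
    trans (cong (_+ c * f n) (∑<-distribˡ-* n c f)) (sym (*-distribˡ-+ c (∑< n f) (f n)))

  ∑<-distribʳ-* : ∀ n c (f : ℕ → ℕ) → ∑< n (λ k → f k * c) ≡ ∑< n f * c
  ∑<-distribʳ-* n c f = begin
    ∑< n (λ k → f k * c) ≡⟨ ∑<-cong n (λ k _ → *-comm (f k) c) ⟩
    ∑< n (λ k → c * f k) ≡⟨ ∑<-distribˡ-* n c f ⟩
    c * ∑< n f           ≡⟨ *-comm c (∑< n f) ⟩
    ∑< n f * c           ∎

  ∑<-comm : ∀ m n (f : ℕ → ℕ → ℕ) → ∑< m (λ i → ∑< n (f i)) ≡ ∑< n (λ j → ∑< m (λ i → f i j))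
  ∑<-comm zero    n f = sym (trans (∑<-const n 0) (*-zeroʳ n))
  ∑<-comm (suc m) n f = begin
    ∑< m (λ i → ∑< n (f i)) + ∑< n (f m)                ≡⟨ cong (_+ ∑< n (f m)) (∑<-comm m n f) ⟩
    ∑< n (λ j → ∑< m (λ i → f i j)) + ∑< n (f m)        ≡⟨ sym (∑<-distrib-+ n _ (f m)) ⟩
    ∑< n (λ j → ∑< m (λ i → f i j) + f m j)             ∎

  ∑<-+ : ∀ a b (f : ℕ → ℕ) → ∑< (a + b) f ≡ ∑< a f + ∑< b (λ i → f (a + i))
  ∑<-+ a zero    f = trans (cong (λ n → ∑< n f) (+-identityʳ a)) (sym (+-identityʳ _))
  ∑<-+ a (suc b) f = begin
    ∑< (a + suc b) f                                ≡⟨ cong (λ n → ∑< n f) (+-suc a b) ⟩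
    ∑< (a + b) f + f (a + b)                        ≡⟨ cong (_+ f (a + b)) (∑<-+ a b f) ⟩
    (∑< a f + ∑< b (λ i → f (a + i))) + f (a + b)   ≡⟨ +-assoc (∑< a f) _ _ ⟩
    ∑< a f + ∑< (suc b) (λ i → f (a + i))           ∎

  ∑<-suc : ∀ n (f : ℕ → ℕ) → ∑< (suc n) f ≡ f 0 + ∑< n (f ∘ suc)
  ∑<-suc n f = ∑<-+ 1 n f

  ∑<-* : ∀ q m (f : ℕ → ℕ) → ∑< (q * m) f ≡ ∑< q (λ k → ∑< m (λ a → f (k * m + a)))
  ∑<-* zero    m f = refl
  ∑<-* (suc q) m f = begin
    ∑< (m + q * m) f                                  ≡⟨ cong (λ n → ∑< n f) (+-comm m (q * m)) ⟩
    ∑< (q * m + m) f                                  ≡⟨ ∑<-+ (q * m) m f ⟩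
    ∑< (q * m) f + ∑< m (λ a → f (q * m + a))         ≡⟨ cong (_+ ∑< m (λ a → f (q * m + a))) (∑<-* q m f) ⟩
    ∑< (suc q) (λ k → ∑< m (λ a → f (k * m + a)))     ∎

  𝟙 : ∀ {P : Set} → Dec P → ℕ
  𝟙 (yes _) = 1
  𝟙 (no _)  = 0

  module _ {P : Set} where

    𝟙-yes : (p : Dec P) → P → 𝟙 p ≡ 1
    𝟙-yes (yes _) _  = refl
    𝟙-yes (no ¬p) p = ⊥-elim (¬p p)

    𝟙-no : (p : Dec P) → ¬ P → 𝟙 p ≡ 0
    𝟙-no (yes p) ¬p = ⊥-elim (¬p p)
    𝟙-no (no _)  _  = refl

    𝟙-cong : ∀ {Q : Set} (p : Dec P) (q : Dec Q) → P ⇔ Q → 𝟙 p ≡ 𝟙 q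
    𝟙-cong (yes _) (yes _) _   = refl
    𝟙-cong (yes p) (no ¬q) P⇔Q = ⊥-elim (¬q (Equivalence.to P⇔Q p))
    𝟙-cong (no ¬p) (yes q) P⇔Q = ⊥-elim (¬p (Equivalence.from P⇔Q q))
    𝟙-cong (no _)  (no _)  _   = refl

  module _ {P : ℕ → Set} (P? : Decidable P) where

    count : ℕ → ℕ
    count n = ∑< n (λ k → 𝟙 (P? k))

    length-filter-upTo : ∀ n → length (filter P? (upTo n)) ≡ count n
    length-filter-upTo zero    = refl
    length-filter-upTo (suc n) = begin
      length (filter P? (upTo (suc n)))                    ≡⟨ cong (length ∘ filter P?) (sym (List.upTo-∷ʳ n)) ⟩
      length (filter P? (upTo n ++ n ∷ []))                ≡⟨ cong length (List.filter-++ P? (upTo n) (n ∷ [])) ⟩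
      length (filter P? (upTo n) ++ filter P? (n ∷ []))    ≡⟨ List.length-++ (filter P? (upTo n)) ⟩
      length (filter P? (upTo n)) + length (filter P? (n ∷ [])) ≡⟨ cong₂ _+_ (length-filter-upTo n) (length-filter-singleton n) ⟩
      count (suc n)                                        ∎
      where
      length-filter-singleton : ∀ x → length (filter P? (x ∷ [])) ≡ 𝟙 (P? x)
      length-filter-singleton x with P? x
      ... | yes _ = refl
      ... | no _  = refl

  module _ {P : ℕ → Set} (P? : Decidable P) where

    ∑<-𝟙-unique : ∀ n a (g : ℕ → ℕ) → a < n → P a → (∀ k → k < n → P k → k ≡ a) →
                  ∑< n (λ k → 𝟙 (P? k) * g k) ≡ g a
    ∑<-𝟙-unique (suc n) a g a<1+n Pa unique with a ≟ n
    ... | yes refl = begin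
      ∑< a (λ k → 𝟙 (P? k) * g k) + 𝟙 (P? a) * g a ≡⟨ cong₂ _+_ (∑<-zero a below-a) (cong (_* g a) (𝟙-yes (P? a) Pa)) ⟩
      0 + (g a + 0)                                 ≡⟨ +-identityʳ (g a) ⟩
      g a                                           ∎
      where
      below-a : ∀ k → k < a → 𝟙 (P? k) * g k ≡ 0
      below-a k k<a = cong (_* g k) (𝟙-no (P? k) (λ Pk → <-irrefl (unique k (m<n⇒m<1+n k<a) Pk) k<a))
    ... | no a≢n = begin
      ∑< n (λ k → 𝟙 (P? k) * g k) + 𝟙 (P? n) * g n ≡⟨ cong₂ _+_ (∑<-𝟙-unique n a g a<n Pa (λ k k<n → unique k (m<n⇒m<1+n k<n)))
                                                               (cong (_* g n) (𝟙-no (P? n) (λ Pn → a≢n (sym (unique n ≤-refl Pn))))) ⟩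
      g a + 0                                       ≡⟨ +-identityʳ (g a) ⟩
      g a                                           ∎
      where
      a<n : a < n
      a<n = ≤∧≢⇒< (s≤s⁻¹ a<1+n) a≢n

    count-unique : ∀ n a → a < n → P a → (∀ k → k < n → P k → k ≡ a) → count P? n ≡ 1
    count-unique n a a<n Pa unique =
      trans (∑<-cong n (λ k _ → sym (*-identityʳ (𝟙 (P? k))))) (∑<-𝟙-unique n a (λ _ → 1) a<n Pa unique)

    count-none : ∀ n → (∀ k → k < n → ¬ P k) → count P? n ≡ 0
    count-none n ¬P = ∑<-zero n (λ k k<n → 𝟙-no (P? k) (¬P k k<n))

    count-all : ∀ n → (∀ k → k < n → P k) → count P? n ≡ n
    count-all n allP = trans (∑<-cong n (λ k k<n → 𝟙-yes (P? k) (allP k k<n))) (trans (∑<-const n 1) (*-identityʳ n))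

  module _ {P : ℕ → Set} (P? : Decidable P) where

    count-two : ∀ n a b → a < n → b < n → a ≢ b → P a → P b → (∀ k → k < n → P k → k ≡ a ⊎ k ≡ b) → count P? n ≡ 2
    count-two n a b a<n b<n a≢b Pa Pb a-or-b = begin
      count P? n                                   ≡⟨ ∑<-cong n split ⟩
      ∑< n (λ k → 𝟙 (k ≟ a) + 𝟙 (k ≟ b))           ≡⟨ ∑<-distrib-+ n _ _ ⟩
      count (_≟ a) n + count (_≟ b) n              ≡⟨ cong₂ _+_ (count-unique (_≟ a) n a a<n refl (λ _ _ → id))
                                                                (count-unique (_≟ b) n b b<n refl (λ _ _ → id)) ⟩
      2                                            ∎
      where
      split : ∀ k → k < n → 𝟙 (P? k) ≡ 𝟙 (k ≟ a) + 𝟙 (k ≟ b)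
      split k k<n with P? k | k ≟ a | k ≟ b
      ... | yes _  | yes refl | yes refl = ⊥-elim (a≢b refl)
      ... | yes _  | yes _    | no _     = refl
      ... | yes _  | no _     | yes _    = refl
      ... | yes Pk | no k≢a   | no k≢b   = ⊥-elim ([ k≢a , k≢b ]′ (a-or-b k k<n Pk))
      ... | no ¬Pk | yes refl | _        = ⊥-elim (¬Pk Pa)
      ... | no ¬Pk | no _     | yes refl = ⊥-elim (¬Pk Pb)
      ... | no _   | no _     | no _     = refl

  count-cong : ∀ {P Q : ℕ → Set} (P? : Decidable P) (Q? : Decidable Q) n →
               (∀ k → k < n → P k ⇔ Q k) → count P? n ≡ count Q? n
  count-cong P? Q? n P⇔Q = ∑<-cong n (λ k k<n → 𝟙-cong (P? k) (Q? k) (P⇔Q k k<n))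

  count-* : ∀ {P : ℕ → Set} (P? : Decidable P) q m → count P? (q * m) ≡ ∑< m (λ a → count (λ k → P? (k * m + a)) q)
  count-* P? q m = trans (∑<-* q m (λ x → 𝟙 (P? x))) (∑<-comm q m (λ k a → 𝟙 (P? (k * m + a))))

module Congruence where

  open import Data.Nat as ℕ using (ℕ; zero; suc; NonZero)
  import Data.Nat.Properties as ℕ
  import Data.Nat.Divisibility as ℕ
  open import Data.Integer using (ℤ; +_; _+_; _-_; _*_; -_; ∣_∣; 0ℤ; 1ℤ)
  open import Data.Integer.Properties using (*-comm; *-identityˡ; pos-*; m-n≡m⊖n; ∣⊖∣-≤; +-identityʳ; +-inverseʳ; *-zeroˡ)
  open import Data.Integer.Divisibility.Signed
  open import Data.Integer.DivMod using (_%ℕ_; _/ℕ_; a≡a%ℕn+[a/ℕn]*n; n%ℕd<d)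
  open import Data.Integer.Tactic.RingSolver using (solve-∀)
  open import Data.Product using (∃-syntax; _×_; _,_)
  open import Data.Sum using (inj₁; inj₂)
  open import Data.Empty using (⊥-elim)
  open import Relation.Binary.Bundles using (Setoid)
  open import Relation.Binary.PropositionalEquality
  open import Relation.Nullary using (Dec)
  open import Relation.Nullary.Decidable using (map′)
  open import Function.Bundles using (_⇔_; mk⇔)
  import Defs
  import Relation.Binary.Reasoning.Setoid

  infix 4 _≋_[mod_] _≋?_[mod_]

  -- A record version of Defs._≡_[mod_], over signed divisibility, so that both sides can be inferred.
  record _≋_[mod_] (a b : ℤ) (m : ℕ) : Set where
    constructor mk≋
    field ≋⇒∣ : + m ∣ a - b
  open _≋_[mod_] public

  ≡mod⇒≋ : ∀ {a b m} → a Defs.≡ b [mod m ] → a ≋ b [mod m ]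
  ≡mod⇒≋ a≡b = mk≋ (∣ᵤ⇒∣ a≡b)

  ≋⇒≡mod : ∀ {a b m} → a ≋ b [mod m ] → a Defs.≡ b [mod m ]
  ≋⇒≡mod (mk≋ m∣a-b) = ∣⇒∣ᵤ m∣a-b

  -- Opaque, so that the type checker compares two decisions by their arguments instead of unfolding them.
  opaque
    _≋?_[mod_] : ∀ a b m → Dec (a ≋ b [mod m ])
    a ≋? b [mod m ] = map′ ≡mod⇒≋ ≋⇒≡mod (a Defs.≡? b [mod m ])

  module _ {m : ℕ} where

    ≋-reflexive : ∀ {a b} → a ≡ b → a ≋ b [mod m ]
    ≋-reflexive {a} refl = mk≋ (divides 0ℤ (trans (+-inverseʳ a) (sym (*-zeroˡ (+ m)))))

    ≋-refl : ∀ {a} → a ≋ a [mod m ]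
    ≋-refl = ≋-reflexive refl

    ≋-sym : ∀ {a b} → a ≋ b [mod m ] → b ≋ a [mod m ]
    ≋-sym {a} {b} (mk≋ m∣a-b) = mk≋ (subst (_ ∣_) (negate-difference a b) (∣m⇒∣-m m∣a-b))
      where
      negate-difference : ∀ a b → - (a - b) ≡ b - a
      negate-difference = solve-∀

    ≋-trans : ∀ {a b c} → a ≋ b [mod m ] → b ≋ c [mod m ] → a ≋ c [mod m ]
    ≋-trans {a} {b} {c} (mk≋ m∣a-b) (mk≋ m∣b-c) = mk≋ (subst (_ ∣_) (telescope a b c) (∣m∣n⇒∣m+n m∣a-b m∣b-c))
      where
      telescope : ∀ a b c → (a - b) + (b - c) ≡ a - c
      telescope = solve-∀

    ≋-+-cong : ∀ {a b c d} → a ≋ b [mod m ] → c ≋ d [mod m ] → a + c ≋ b + d [mod m ]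
    ≋-+-cong {a} {b} {c} {d} (mk≋ m∣a-b) (mk≋ m∣c-d) = mk≋ (subst (_ ∣_) (regroup a b c d) (∣m∣n⇒∣m+n m∣a-b m∣c-d))
      where
      regroup : ∀ a b c d → (a - b) + (c - d) ≡ (a + c) - (b + d)
      regroup = solve-∀

    ≋-+-congˡ : ∀ c {a b} → a ≋ b [mod m ] → c + a ≋ c + b [mod m ]
    ≋-+-congˡ c = ≋-+-cong (≋-refl {c})

    ≋-*-congˡ : ∀ c {a b} → a ≋ b [mod m ] → c * a ≋ c * b [mod m ]
    ≋-*-congˡ c {a} {b} (mk≋ m∣a-b) = mk≋ (subst (_ ∣_) (distrib c a b) (∣n⇒∣m*n c m∣a-b))
      where
      distrib : ∀ c a b → c * (a - b) ≡ c * a - c * b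
      distrib = solve-∀

    ≋-*-cong : ∀ {a b c d} → a ≋ b [mod m ] → c ≋ d [mod m ] → a * c ≋ b * d [mod m ]
    ≋-*-cong {a} {b} {c} {d} a≋b c≋d = ≋-trans (≋-reflexive (*-comm a c))
      (≋-trans (≋-*-congˡ c a≋b) (≋-trans (≋-reflexive (*-comm c b)) (≋-*-congˡ b c≋d)))

    a+q*m≋a : ∀ a q → a + q * + m ≋ a [mod m ]
    a+q*m≋a a q = mk≋ (divides q (cancel a (q * + m)))
      where
      cancel : ∀ a b → a + b - a ≡ b
      cancel = solve-∀

    ≋0⇒∣ : ∀ {a} → a ≋ 0ℤ [mod m ] → + m ∣ a
    ≋0⇒∣ {a} (mk≋ m∣a-0) = subst (_ ∣_) (+-identityʳ a) m∣a-0

    ∣⇒≋0 : ∀ {a} → + m ∣ a → a ≋ 0ℤ [mod m ]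
    ∣⇒≋0 {a} m∣a = mk≋ (subst (_ ∣_) (sym (+-identityʳ a)) m∣a)

    -≋0⇔≋ : ∀ {a b} → a - b ≋ 0ℤ [mod m ] ⇔ a ≋ b [mod m ]
    -≋0⇔≋ = mk⇔ (λ a-b≋0 → mk≋ (≋0⇒∣ a-b≋0)) (λ a≋b → ∣⇒≋0 (≋⇒∣ a≋b))

    ≋-setoid : Setoid _ _
    ≋-setoid = record
      { Carrier = ℤ
      ; _≈_ = _≋_[mod m ]
      ; isEquivalence = record { refl = ≋-refl ; sym = ≋-sym ; trans = ≋-trans }
      }

  module ≋-Reasoning (m : ℕ) = Relation.Binary.Reasoning.Setoid (≋-setoid {m})

  ≋-weaken : ∀ {a b m n} → m ℕ.∣ n → a ≋ b [mod n ] → a ≋ b [mod m ]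
  ≋-weaken {m = m} (ℕ.divides k refl) (mk≋ n∣a-b) = mk≋ (∣-trans (divides (+ k) (pos-* k m)) n∣a-b)

  ≋-*-scale : ∀ c {a b m} → a ≋ b [mod m ] → + c * a ≋ + c * b [mod c ℕ.* m ]
  ≋-*-scale c {a} {b} {m} (mk≋ (divides q a-b≡q*m)) = mk≋ (divides q (begin
    + c * a - + c * b   ≡⟨ distrib (+ c) a b ⟩
    + c * (a - b)       ≡⟨ cong (+ c *_) a-b≡q*m ⟩
    + c * (q * + m)     ≡⟨ rotate (+ c) q (+ m) ⟩
    q * (+ c * + m)     ≡⟨ cong (q *_) (pos-* c m) ⟨
    q * + (c ℕ.* m)     ∎))
    where
    open ≡-Reasoning
    distrib : ∀ c a b → c * a - c * b ≡ c * (a - b)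
    distrib = solve-∀
    rotate : ∀ c q m → c * (q * m) ≡ q * (c * m)
    rotate = solve-∀

  ≋-*-cancel : ∀ c {a b m} .{{_ : NonZero c}} → + c * a ≋ + c * b [mod c ℕ.* m ] → a ≋ b [mod m ]
  ≋-*-cancel c {a} {b} {m} (mk≋ cm∣ca-cb) = mk≋ (*-cancelˡ-∣ (+ c) (subst₂ _∣_ (pos-* c m) (distrib (+ c) a b) cm∣ca-cb))
    where
    distrib : ∀ c a b → c * a - c * b ≡ c * (a - b)
    distrib = solve-∀

  ≋-*-divide : ∀ c {a z m} .{{_ : NonZero c}} → + c * a ≋ z [mod c ℕ.* m ] → ∃[ z′ ] z ≡ + c * z′ × a ≋ z′ [mod m ]
  ≋-*-divide c {a} {z} {m} ca≋z with c∣z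
    where
    cancel : ∀ x z → x - (x - z) ≡ z
    cancel = solve-∀
    c∣z : + c ∣ z
    c∣z = subst (+ c ∣_) (cancel (+ c * a) z) (∣m∣n⇒∣m-n (∣m⇒∣m*n a ∣-refl) (≋⇒∣ (≋-weaken (ℕ.m∣m*n m) ca≋z)))
  ... | divides z′ z≡z′c = z′ , z≡cz′ , ≋-*-cancel c (≋-trans ca≋z (≋-reflexive z≡cz′))
    where
    z≡cz′ : z ≡ + c * z′
    z≡cz′ = trans z≡z′c (*-comm z′ (+ c))

  ≋-+-cancelˡ : ∀ c {a b m} → c + a ≋ c + b [mod m ] → a ≋ b [mod m ]
  ≋-+-cancelˡ c {a} {b} (mk≋ m∣) = mk≋ (subst (_ ∣_) (cancel c a b) m∣)
    where
    cancel : ∀ c a b → (c + a) - (c + b) ≡ a - b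
    cancel = solve-∀

  ≋-cancelˡ-unit : ∀ {u v a b m} → u * v ≋ 1ℤ [mod m ] → u * a ≋ u * b [mod m ] → a ≋ b [mod m ]
  ≋-cancelˡ-unit {u} {v} {a} {b} {m} uv≋1 ua≋ub = begin
    a             ≡⟨ *-identityˡ a ⟨
    1ℤ * a        ≈⟨ ≋-*-cong (≋-sym uv≋1) ≋-refl ⟩
    (u * v) * a   ≡⟨ swap u v a ⟩
    v * (u * a)   ≈⟨ ≋-*-congˡ v ua≋ub ⟩
    v * (u * b)   ≡⟨ swap u v b ⟨
    (u * v) * b   ≈⟨ ≋-*-cong uv≋1 ≋-refl ⟩
    1ℤ * b        ≡⟨ *-identityˡ b ⟩
    b             ∎
    where
    open ≋-Reasoning m
    swap : ∀ u v a → (u * v) * a ≡ v * (u * a)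
    swap = solve-∀

  residue : ∀ y n .{{_ : NonZero n}} → ∃[ k ] k ℕ.< n × + k ≋ y [mod n ]
  residue y n = y %ℕ n , n%ℕd<d y n , ≋-sym (mk≋ (divides (y /ℕ n) (begin
    y - + (y %ℕ n)                            ≡⟨ cong (_- + (y %ℕ n)) (a≡a%ℕn+[a/ℕn]*n y n) ⟩
    + (y %ℕ n) + (y /ℕ n) * + n - + (y %ℕ n)  ≡⟨ cancel (+ (y %ℕ n)) ((y /ℕ n) * + n) ⟩
    (y /ℕ n) * + n                            ∎)))
    where
    open ≡-Reasoning
    cancel : ∀ a b → a + b - a ≡ b
    cancel = solve-∀

  private
    residue-unique-≤ : ∀ {k k′ n} → k ℕ.≤ k′ → k′ ℕ.< n → + k ≋ + k′ [mod n ] → k ≡ k′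
    residue-unique-≤ {k} {k′} {n} k≤k′ k′<n (mk≋ n∣k-k′) =
      ℕ.≤-antisym k≤k′ (ℕ.m∸n≡0⇒m≤n (small-multiple (k′ ℕ.∸ k) n∣k′-k k′-k<n))
      where
      n∣k′-k : n ℕ.∣ k′ ℕ.∸ k
      n∣k′-k = subst (n ℕ.∣_) (trans (cong ∣_∣ (m-n≡m⊖n k k′)) (∣⊖∣-≤ k≤k′)) (∣⇒∣ᵤ n∣k-k′)
      k′-k<n : k′ ℕ.∸ k ℕ.< n
      k′-k<n = ℕ.≤-<-trans (ℕ.m∸n≤m k′ k) k′<n
      small-multiple : ∀ d → n ℕ.∣ d → d ℕ.< n → d ≡ 0
      small-multiple zero    _   _   = refl
      small-multiple (suc d) n∣d d<n = ⊥-elim (ℕ.>⇒∤ d<n n∣d)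

  residue-unique : ∀ {k k′ n} → k ℕ.< n → k′ ℕ.< n → + k ≋ + k′ [mod n ] → k ≡ k′
  residue-unique {k} {k′} k<n k′<n k≋k′ with ℕ.≤-total k k′
  ... | inj₁ k≤k′ = residue-unique-≤ k≤k′ k′<n k≋k′
  ... | inj₂ k′≤k = sym (residue-unique-≤ k′≤k k<n (≋-sym k≋k′))

module Squares where

  open import Data.Nat as ℕ using (ℕ; NonZero)
  import Data.Nat.Properties as ℕ
  import Data.Nat.Divisibility as ℕ
  open import Data.Integer using (ℤ; +_; _+_; _-_; _*_; 0ℤ; 1ℤ)
  open import Data.Integer.Properties using (*-identityʳ)
  open import Data.Integer.Tactic.RingSolver using (solve-∀)
  open import Data.Product using (∃-syntax; _×_; _,_)
  open import Data.Integer.Divisibility.Signed using (_∣_; divides)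
  open import Data.List.Relation.Unary.Any using (satisfied)
  open import Data.List.Relation.Unary.Any.Properties using (applyUpTo⁺)
  open import Relation.Binary.PropositionalEquality
  open import Relation.Nullary using (Dec)
  open import Relation.Nullary.Decidable using (map′)
  open import Function using (id)
  open import Function.Bundles using (mk⇔)
  import Defs
  open Counting
  open Congruence

  IsSquare : ℕ → ℤ → Set
  IsSquare m z = ∃[ y ] y * y ≋ z [mod m ]

  IsSquareMod⇒IsSquare : ∀ {m z} → Defs.IsSquareMod m z → IsSquare m z
  IsSquareMod⇒IsSquare sq with satisfied sq
  ... | y , y²≡z = + y , ≡mod⇒≋ y²≡z

  IsSquare⇒IsSquareMod : ∀ {m z} .{{_ : NonZero m}} → IsSquare m z → Defs.IsSquareMod m z
  IsSquare⇒IsSquareMod {m} (y , y²≋z) with residue y m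
  ... | k , k<m , k≋y = applyUpTo⁺ id (≋⇒≡mod (≋-trans (≋-*-cong k≋y k≋y) y²≋z)) k<m

  -- Opaque for the same reason as _≋?_[mod_].
  opaque
    isSquare? : ∀ m .{{_ : NonZero m}} z → Dec (IsSquare m z)
    isSquare? m z = map′ IsSquareMod⇒IsSquare IsSquare⇒IsSquareMod (Defs.isSquareMod? m z)

  IsSquare-resp-≋ : ∀ {m a b} → a ≋ b [mod m ] → IsSquare m a → IsSquare m b
  IsSquare-resp-≋ a≋b (y , y²≋a) = y , ≋-trans y²≋a a≋b

  IsSquare-weaken : ∀ {m n z} → m ℕ.∣ n → IsSquare n z → IsSquare m z
  IsSquare-weaken m∣n (y , y²≋z) = y , ≋-weaken m∣n y²≋z

  IsSquare-mod-1 : ∀ z → IsSquare 1 z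
  IsSquare-mod-1 z = 0ℤ , mk≋ (divides (0ℤ - z) (sym (*-identityʳ (0ℤ - z))))

  IsSquare-*-scale : ∀ c {m z} → IsSquare m z → IsSquare (c ℕ.* (c ℕ.* m)) (+ c * (+ c * z))
  IsSquare-*-scale c (y , y²≋z) = + c * y , ≋-trans (≋-reflexive (square-product (+ c) y)) (≋-*-scale c (≋-*-scale c y²≋z))
    where
    square-product : ∀ c y → (c * y) * (c * y) ≡ c * (c * (y * y))
    square-product = solve-∀

  IsSquare-*-square : ∀ c {m a} → IsSquare m a → IsSquare m (c * c * a)
  IsSquare-*-square c (y , y²≋a) = c * y , ≋-trans (≋-reflexive (square-product c y)) (≋-*-congˡ (c * c) y²≋a)
    where
    square-product : ∀ c y → (c * y) * (c * y) ≡ c * c * (y * y)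
    square-product = solve-∀

  private
    square-*ʳ : ∀ y c → (y * c) * (y * c) ≡ c * (c * (y * y))
    square-*ʳ = solve-∀

  IsSquare-*-divide : ∀ c {m y z} .{{_ : NonZero c}} → + c ∣ y → y * y ≋ z [mod c ℕ.* (c ℕ.* m) ] →
                      ∃[ z₁ ] z ≡ + c * (+ c * z₁) × IsSquare m z₁
  IsSquare-*-divide c {m} {y} {z} (divides y₁ y≡y₁c) y²≋z =
    let z′ , z≡cz′ , cy₁²≋z′ = ≋-*-divide c {+ c * (y₁ * y₁)} c²y₁²≋z
        z₁ , z′≡cz₁ , y₁²≋z₁ = ≋-*-divide c {y₁ * y₁} cy₁²≋z′
    in z₁ , trans z≡cz′ (cong (+ c *_) z′≡cz₁) , (y₁ , y₁²≋z₁)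
    where
    c²y₁²≋z : + c * (+ c * (y₁ * y₁)) ≋ z [mod c ℕ.* (c ℕ.* m) ]
    c²y₁²≋z = ≋-trans (≋-reflexive (sym (trans (cong (λ x → x * x) y≡y₁c) (square-*ʳ y₁ (+ c))))) y²≋z

  count-≋0 : ∀ n .{{_ : NonZero n}} → count (λ k → + k ≋? 0ℤ [mod n ]) n ≡ 1
  count-≋0 n = count-unique (λ k → + k ≋? 0ℤ [mod n ]) n 0 0<n ≋-refl (λ k k<n k≋0 → residue-unique k<n 0<n k≋0)
    where
    0<n : 0 ℕ.< n
    0<n = ℕ.>-nonZero⁻¹ n

  -- k ↦ c + u k permutes the residues mod n; the count is compared by double counting the graph of this map.
  module _ (n : ℕ) .{{_ : NonZero n}} {P : ℤ → Set} (P? : ∀ z → Dec (P z))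
           (P-resp-≋ : ∀ {a b} → a ≋ b [mod n ] → P a → P b)
           (c u v : ℤ) (uv≋1 : u * v ≋ 1ℤ [mod n ]) where

    private
      Graph? : ∀ k j → Dec (+ j ≋ c + u * + k [mod n ])
      Graph? k j = + j ≋? c + u * + k [mod n ]

      fibre-of-k : ∀ k → ∑< n (λ j → 𝟙 (Graph? k j) ℕ.* 𝟙 (P? (+ j))) ≡ 𝟙 (P? (c + u * + k))
      fibre-of-k k with residue (c + u * + k) n
      ... | j₀ , j₀<n , j₀≋ = trans
        (∑<-𝟙-unique (Graph? k) n j₀ (λ j → 𝟙 (P? (+ j))) j₀<n j₀≋
           (λ j j<n j≋ → residue-unique j<n j₀<n (≋-trans j≋ (≋-sym j₀≋))))
        (𝟙-cong (P? (+ j₀)) (P? (c + u * + k)) (mk⇔ (P-resp-≋ j₀≋) (P-resp-≋ (≋-sym j₀≋))))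

      fibre-of-j : ∀ j → count (λ k → Graph? k j) n ≡ 1
      fibre-of-j j with residue ((+ j - c) * v) n
      ... | k₀ , k₀<n , k₀≋ = count-unique (λ k → Graph? k j) n k₀ k₀<n hits-j
            (λ k k<n k-hits → residue-unique k<n k₀<n (≋-cancelˡ-unit {u} {v} uv≋1 (≋-+-cancelˡ c (≋-trans (≋-sym k-hits) hits-j))))
        where
        hits-j : + j ≋ c + u * + k₀ [mod n ]
        hits-j = ≋-sym (begin
          c + u * + k₀              ≈⟨ ≋-+-congˡ c (≋-*-congˡ u k₀≋) ⟩
          c + u * ((+ j - c) * v)   ≡⟨ reassociate c u (+ j - c) v ⟩
          c + (+ j - c) * (u * v)   ≈⟨ ≋-+-congˡ c (≋-*-congˡ (+ j - c) uv≋1) ⟩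
          c + (+ j - c) * 1ℤ        ≡⟨ cancel c (+ j) ⟩
          + j                       ∎)
          where
          open ≋-Reasoning n
          reassociate : ∀ c u w v → c + u * (w * v) ≡ c + w * (u * v)
          reassociate = solve-∀
          cancel : ∀ c j → c + (j - c) * 1ℤ ≡ j
          cancel = solve-∀

    count-affine : count (λ k → P? (c + u * + k)) n ≡ count (λ k → P? (+ k)) n
    count-affine = begin
      ∑< n (λ k → 𝟙 (P? (c + u * + k)))
        ≡⟨ ∑<-cong n (λ k _ → fibre-of-k k) ⟨
      ∑< n (λ k → ∑< n (λ j → 𝟙 (Graph? k j) ℕ.* 𝟙 (P? (+ j))))
        ≡⟨ ∑<-comm n n _ ⟩
      ∑< n (λ j → ∑< n (λ k → 𝟙 (Graph? k j) ℕ.* 𝟙 (P? (+ j))))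
        ≡⟨ ∑<-cong n (λ j _ → ∑<-distribʳ-* n _ (λ k → 𝟙 (Graph? k j))) ⟩
      ∑< n (λ j → count (λ k → Graph? k j) n ℕ.* 𝟙 (P? (+ j)))
        ≡⟨ ∑<-cong n (λ j _ → trans (cong (ℕ._* 𝟙 (P? (+ j))) (fibre-of-j j)) (ℕ.*-identityˡ _)) ⟩
      ∑< n (λ j → 𝟙 (P? (+ j)))
        ∎
      where open ≡-Reasoning

module OddPrime (r : ℕ) (r-prime : Prime r) (r≢2 : r ≢ 2) where

  open import Data.Nat as ℕ using (ℕ; zero; suc; NonZero; _^_)
  open import Relation.Binary.PropositionalEquality
  import Data.Nat.Properties as ℕ
  import Data.Nat.Divisibility as ℕ
  open import Data.Nat.Primality using (euclidsLemma; prime⇒nonZero; prime⇒nonTrivial; prime⇒irreducible)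
  open import Data.Nat.Coprimality using (Coprime; coprime-Bézout)
  open import Data.Nat.GCD using (module Bézout)
  open import Data.Integer using (ℤ; +_; _+_; _-_; _*_; -_; ∣_∣; 0ℤ; 1ℤ)
  open import Data.Integer.Properties using (abs-*; pos-*; pos-+; *-comm; *-identityˡ; *-identityʳ; *-cancelˡ-≡)
  open import Data.Integer.Divisibility.Signed
  open import Data.Integer.Tactic.RingSolver using (solve-∀)
  open import Data.Nat.Tactic.RingSolver using () renaming (solve-∀ to ℕ-solve-∀)
  open import Data.Product using (∃-syntax; _,_)
  open import Data.Sum using (_⊎_; inj₁; inj₂)
  open import Data.Empty using (⊥-elim)
  open import Relation.Nullary using (Dec; ¬_; yes; no)
  open import Function.Bundles using (_⇔_; mk⇔; Equivalence)
  open Counting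
  open Congruence
  open Squares

  instance
    r-nonZero : NonZero r
    r-nonZero = prime⇒nonZero r-prime

  r^-nonZero : ∀ e → NonZero (r ^ e)
  r^-nonZero e = ℕ.m^n≢0 r e

  1<r : 1 ℕ.< r
  1<r = ℕ.nonTrivial⇒n>1 r {{prime⇒nonTrivial r-prime}}

  0<r : 0 ℕ.< r
  0<r = ℕ.<-trans ℕ.z<s 1<r

  euclidsLemmaℤ : ∀ a b → (+ r ∣ a * b) → (+ r ∣ a) ⊎ (+ r ∣ b)
  euclidsLemmaℤ a b r∣ab with euclidsLemma ∣ a ∣ ∣ b ∣ r-prime (subst (r ℕ.∣_) (abs-* a b) (∣⇒∣ᵤ r∣ab))
  ... | inj₁ r∣a = inj₁ (∣ᵤ⇒∣ r∣a)
  ... | inj₂ r∣b = inj₂ (∣ᵤ⇒∣ r∣b)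

  r∤* : ∀ {a b} → ¬ (+ r ∣ a) → ¬ (+ r ∣ b) → ¬ (+ r ∣ a * b)
  r∤* {a} {b} r∤a r∤b r∣ab with euclidsLemmaℤ a b r∣ab
  ... | inj₁ r∣a = r∤a r∣a
  ... | inj₂ r∣b = r∤b r∣b

  r∣²⇒r∣ : ∀ {a} → (+ r ∣ a * a) → (+ r ∣ a)
  r∣²⇒r∣ {a} r∣aa with euclidsLemmaℤ a a r∣aa
  ... | inj₁ r∣a = r∣a
  ... | inj₂ r∣a = r∣a

  r∣-square-root : ∀ {M y z} → r ℕ.∣ M → y * y ≋ z [mod M ] → + r ∣ z → + r ∣ y
  r∣-square-root {y = y} r∣M y²≋z r∣z = r∣²⇒r∣ {y} (≋0⇒∣ (≋-trans (≋-weaken r∣M y²≋z) (∣⇒≋0 r∣z)))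

  r∤2 : ¬ (+ r ∣ + 2)
  r∤2 r∣2 = r≢2 (ℕ.≤-antisym (ℕ.∣⇒≤ (∣⇒∣ᵤ r∣2)) 1<r)

  private
    inverse-of-residue : ∀ k → ¬ (r ℕ.∣ k) → ∃[ v ] + k * v ≋ 1ℤ [mod r ]
    inverse-of-residue k r∤k with coprime-Bézout k⊥r
      where
      k⊥r : Coprime k r
      k⊥r (d∣k , d∣r) with prime⇒irreducible r-prime d∣r
      ... | inj₁ d≡1 = d≡1
      ... | inj₂ refl = ⊥-elim (r∤k d∣k)
    ... | Bézout.+- x y 1+yr≡xk = + x , mk≋ (divides (+ y) (begin
      + k * + x - 1ℤ               ≡⟨ cong (_- 1ℤ) (pos-* k x) ⟨
      + (k ℕ.* x) - 1ℤ             ≡⟨ cong (λ n → + n - 1ℤ) (trans (ℕ.*-comm k x) (sym 1+yr≡xk)) ⟩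
      + (1 ℕ.+ y ℕ.* r) - 1ℤ       ≡⟨ cong (_- 1ℤ) (trans (pos-+ 1 (y ℕ.* r)) (cong (λ a → 1ℤ + a) (pos-* y r))) ⟩
      1ℤ + + y * + r - 1ℤ          ≡⟨ cancel (+ y * + r) ⟩
      + y * + r                    ∎))
      where
      open ≡-Reasoning
      cancel : ∀ a → 1ℤ + a - 1ℤ ≡ a
      cancel = solve-∀
    ... | Bézout.-+ x y 1+xk≡yr = - + x , mk≋ (divides (- + y) (begin
      + k * - + x - 1ℤ             ≡⟨ negate (+ k) (+ x) ⟩
      - (1ℤ + + k * + x)           ≡⟨ cong -_ (trans (cong (λ a → 1ℤ + a) (sym (pos-* k x))) (sym (pos-+ 1 (k ℕ.* x)))) ⟩
      - + (1 ℕ.+ k ℕ.* x)          ≡⟨ cong (λ n → - + n) (trans (cong (1 ℕ.+_) (ℕ.*-comm k x)) 1+xk≡yr) ⟩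
      - + (y ℕ.* r)                ≡⟨ cong -_ (pos-* y r) ⟩
      - (+ y * + r)                ≡⟨ negate-left (+ y) (+ r) ⟩
      - + y * + r                  ∎))
      where
      open ≡-Reasoning
      negate : ∀ k x → k * - x - 1ℤ ≡ - (1ℤ + k * x)
      negate = solve-∀
      negate-left : ∀ y r → - (y * r) ≡ - y * r
      negate-left = solve-∀

  invertible : ∀ {u} → ¬ (+ r ∣ u) → ∃[ v ] u * v ≋ 1ℤ [mod r ]
  invertible {u} r∤u with residue u r
  ... | k , _ , k≋u with inverse-of-residue k (λ r∣k → r∤u (≋0⇒∣ (≋-trans (≋-sym k≋u) (∣⇒≋0 (∣ᵤ⇒∣ r∣k)))))
  ... | v , kv≋1 = v , ≋-trans (≋-*-cong (≋-sym k≋u) ≋-refl) kv≋1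

  ≋-square-roots : ∀ {a b} → a * a ≋ b * b [mod r ] → (a ≋ b [mod r ]) ⊎ (a ≋ - b [mod r ])
  ≋-square-roots {a} {b} (mk≋ r∣a²-b²) with euclidsLemmaℤ (a - b) (a + b) (subst (+ r ∣_) (factor a b) r∣a²-b²)
    where
    factor : ∀ a b → a * a - b * b ≡ (a - b) * (a + b)
    factor = solve-∀
  ... | inj₁ r∣a-b = inj₁ (mk≋ r∣a-b)
  ... | inj₂ r∣a+b = inj₂ (mk≋ (subst (+ r ∣_) (double-negation a b) r∣a+b))
    where
    double-negation : ∀ a b → a + b ≡ a - - b
    double-negation = solve-∀

  private
    square-roots-of-nonzero : ∀ {z w} → w * w ≋ z [mod r ] → ¬ (z ≋ 0ℤ [mod r ]) →
                              count (λ y → + y * + y ≋? z [mod r ]) r ≡ 2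
    square-roots-of-nonzero {z} {w} w²≋z z≉0 with residue w r | residue (- w) r
    ... | y₀ , y₀<r , y₀≋w | y₁ , y₁<r , y₁≋-w =
      count-two (λ y → + y * + y ≋? z [mod r ]) r y₀ y₁ y₀<r y₁<r y₀≢y₁
        (≋-trans (≋-*-cong y₀≋w y₀≋w) w²≋z)
        (≋-trans (≋-*-cong y₁≋-w y₁≋-w) (≋-trans (≋-reflexive (neg-square w)) w²≋z))
        y₀-or-y₁
      where
      neg-square : ∀ w → - w * - w ≡ w * w
      neg-square = solve-∀
      w≉0 : ¬ (+ r ∣ w)
      w≉0 r∣w = z≉0 (≋-trans (≋-sym w²≋z) (∣⇒≋0 (∣m⇒∣m*n w r∣w)))
      y₀≢y₁ : y₀ ≢ y₁
      y₀≢y₁ refl = r∤* r∤2 w≉0 (subst (+ r ∣_) (twice w) (≋⇒∣ (≋-trans (≋-sym y₀≋w) y₁≋-w)))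
        where
        twice : ∀ w → w - - w ≡ + 2 * w
        twice = solve-∀
      y₀-or-y₁ : ∀ k → k ℕ.< r → + k * + k ≋ z [mod r ] → k ≡ y₀ ⊎ k ≡ y₁
      y₀-or-y₁ k k<r k²≋z with ≋-square-roots {+ k} {w} (≋-trans k²≋z (≋-sym w²≋z))
      ... | inj₁ k≋w  = inj₁ (residue-unique k<r y₀<r (≋-trans k≋w (≋-sym y₀≋w)))
      ... | inj₂ k≋-w = inj₂ (residue-unique k<r y₁<r (≋-trans k≋-w (≋-sym y₁≋-w)))

    square-roots-of-zero : ∀ {z} → z ≋ 0ℤ [mod r ] → count (λ y → + y * + y ≋? z [mod r ]) r ≡ 1
    square-roots-of-zero {z} z≋0 = count-unique (λ y → + y * + y ≋? z [mod r ]) r 0 0<r (≋-sym z≋0)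
      (λ k k<r k²≋z → residue-unique k<r 0<r (∣⇒≋0 (r∣²⇒r∣ {+ k} (≋0⇒∣ (≋-trans k²≋z z≋0)))))

  square-roots : ∀ z → count (λ y → + y * + y ≋? z [mod r ]) r ℕ.+ 𝟙 (z ≋? 0ℤ [mod r ]) ≡ 2 ℕ.* 𝟙 (isSquare? r z)
  square-roots z with isSquare? r z | z ≋? 0ℤ [mod r ]
  ... | no ¬sq       | yes z≋0 = ⊥-elim (¬sq (0ℤ , ≋-sym z≋0))
  ... | no ¬sq       | no _    = trans (ℕ.+-identityʳ _) (count-none _ r (λ y _ y²≋z → ¬sq (+ y , y²≋z)))
  ... | yes _        | yes z≋0 = cong (ℕ._+ 1) (square-roots-of-zero z≋0)
  ... | yes (w , w²≋z) | no z≉0 = trans (ℕ.+-identityʳ _) (square-roots-of-nonzero {z} {w} w²≋z z≉0)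

  count-squares : 2 ℕ.* count (λ j → isSquare? r (+ j)) r ≡ r ℕ.+ 1
  count-squares = begin
    2 ℕ.* ∑< r (λ j → 𝟙 (isSquare? r (+ j)))
      ≡⟨ ∑<-distribˡ-* r 2 _ ⟨
    ∑< r (λ j → 2 ℕ.* 𝟙 (isSquare? r (+ j)))
      ≡⟨ ∑<-cong r (λ j _ → square-roots (+ j)) ⟨
    ∑< r (λ j → ∑< r (λ y → 𝟙 (Root? y j)) ℕ.+ 𝟙 (+ j ≋? 0ℤ [mod r ]))
      ≡⟨ ∑<-distrib-+ r _ _ ⟩
    ∑< r (λ j → ∑< r (λ y → 𝟙 (Root? y j))) ℕ.+ count (λ j → + j ≋? 0ℤ [mod r ]) r
      ≡⟨ cong₂ ℕ._+_ (∑<-comm r r _) (count-≋0 r) ⟩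
    ∑< r (λ y → count (Root? y) r) ℕ.+ 1
      ≡⟨ cong (ℕ._+ 1) (trans (∑<-cong r (λ y _ → one-square y)) (trans (∑<-const r 1) (ℕ.*-identityʳ r))) ⟩
    r ℕ.+ 1
      ∎
    where
    open ≡-Reasoning
    Root? : ∀ y j → Dec (+ y * + y ≋ + j [mod r ])
    Root? y j = + y * + y ≋? + j [mod r ]
    one-square : ∀ y → count (Root? y) r ≡ 1
    one-square y with residue (+ y * + y) r
    ... | j₀ , j₀<r , j₀≋y² = count-unique (Root? y) r j₀ j₀<r (≋-sym j₀≋y²)
          (λ j j<r y²≋j → residue-unique j<r j₀<r (≋-trans (≋-sym y²≋j) (≋-sym j₀≋y²)))

  private
    hensel-correction : ∀ {y z d w q} R → y * y - z ≡ d * + (R ℕ.* r) → (+ 2 * y) * w - 1ℤ ≡ q * + r →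
                        (y - d * w * + (R ℕ.* r)) * (y - d * w * + (R ℕ.* r)) - z
                          ≡ (d * w * (d * w) * + R - d * q) * + (r ℕ.* (R ℕ.* r))
    hensel-correction {y} {z} {d} {w} {q} R y²-z≡dM 2yw-1≡qr = begin
      (y - d * w * M) * (y - d * w * M) - z
        ≡⟨ expand y z d w M ⟩
      (y * y - z) - d * M * ((+ 2 * y) * w - 1ℤ) - d * M + d * w * (d * w) * (M * M)
        ≡⟨ cong₂ (λ a b → a - d * M * b - d * M + d * w * (d * w) * (M * M)) y²-z≡dM 2yw-1≡qr ⟩
      F M
        ≡⟨ cong F (pos-* R r) ⟩
      F (+ R * + r)
        ≡⟨ collect d w q (+ R) (+ r) ⟩
      Q * (+ r * (+ R * + r))
        ≡⟨ cong (Q *_) (trans (pos-* r (R ℕ.* r)) (cong (+ r *_) (pos-* R r))) ⟨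
      Q * + (r ℕ.* (R ℕ.* r))
        ∎
      where
      open ≡-Reasoning
      M : ℤ
      M = + (R ℕ.* r)
      Q : ℤ
      Q = d * w * (d * w) * + R - d * q
      F : ℤ → ℤ
      F m = d * m - d * m * (q * + r) - d * m + d * w * (d * w) * (m * m)
      expand : ∀ y z d w M → (y - d * w * M) * (y - d * w * M) - z ≡
               (y * y - z) - d * M * ((+ 2 * y) * w - 1ℤ) - d * M + d * w * (d * w) * (M * M)
      expand = solve-∀
      collect : ∀ d w q R r → d * (R * r) - d * (R * r) * (q * r) - d * (R * r) + d * w * (d * w) * ((R * r) * (R * r)) ≡
                (d * w * (d * w) * R - d * q) * (r * (R * r))
      collect = solve-∀

  -- Newton's step: the witness is y − (y² − z) (2y)⁻¹, with the inverse of 2y taken modulo r.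
  hensel-unit : ∀ {M y z} → r ℕ.∣ M → y * y ≋ z [mod M ] → ¬ (+ r ∣ y) → IsSquare (r ℕ.* M) z
  hensel-unit {y = y} {z} (ℕ.divides R refl) (mk≋ (divides d y²-z≡dM)) r∤y =
    let w , mk≋ (divides q 2yw-1≡qr) = invertible {+ 2 * y} (r∤* {+ 2} {y} r∤2 r∤y)
    in y - d * w * + (R ℕ.* r) , mk≋ (divides (d * w * (d * w) * + R - d * q) (hensel-correction {y} {z} {d} {w} {q} R y²-z≡dM 2yw-1≡qr))

  r∣r^suc : ∀ e → + r ∣ + (r ^ suc e)
  r∣r^suc e = ∣ᵤ⇒∣ {+ r} {+ (r ^ suc e)} (ℕ.m∣m*n (r ^ e))

  private
    +r²* : ∀ m → + (r ℕ.* (r ℕ.* m)) ≡ + r * (+ r * + m)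
    +r²* m = trans (pos-* r (r ℕ.* m)) (cong (+ r *_) (pos-* r m))

  -- If r ∣ y then r² ∣ z, and the problem descends to z / r² modulo r^(e − 2).
  hensel : ∀ e {y z} → y * y ≋ z [mod r ^ e ] → ¬ (+ (r ^ e) ∣ z) → IsSquare (r ^ suc e) z
  hensel-r∣ : ∀ e {y z} → + r ∣ y → y * y ≋ z [mod r ^ suc e ] → ¬ (+ (r ^ suc e) ∣ z) → IsSquare (r ^ suc (suc e)) z

  hensel zero    {z = z} _ 1∤z = ⊥-elim (1∤z (divides z (sym (*-identityʳ z))))
  hensel (suc e) {y} {z} y²≋z r^e∤z with + r ∣? y
  ... | no r∤y  = hensel-unit {r ^ suc e} {y} {z} (ℕ.m∣m*n (r ^ e)) y²≋z r∤y
  ... | yes r∣y = hensel-r∣ e {y} {z} r∣y y²≋z r^e∤z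

  hensel-r∣ zero    {y} {z} r∣y y²≋z r∤z = ⊥-elim (r∤z (≋0⇒∣ (≋-weaken (ℕ.∣-reflexive (ℕ.*-identityʳ r)) z≋0)))
    where
    z≋0 : z ≋ 0ℤ [mod r ]
    z≋0 = ≋-trans (≋-sym (≋-weaken (ℕ.∣-reflexive (sym (ℕ.*-identityʳ r))) y²≋z)) (∣⇒≋0 (∣m⇒∣m*n y r∣y))
  hensel-r∣ (suc e) {y} {z} r∣y y²≋z r^e+2∤z =
    let z₁ , z≡r²z₁ , (y₁ , y₁²≋z₁) = IsSquare-*-divide r {r ^ e} {y} {z} r∣y y²≋z
        r^e∤z₁ : ¬ (+ (r ^ e) ∣ z₁)
        r^e∤z₁ r^e∣z₁ = r^e+2∤z (subst₂ _∣_ (sym (+r²* (r ^ e))) (sym z≡r²z₁) (*-monoʳ-∣ (+ r) (*-monoʳ-∣ (+ r) r^e∣z₁)))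
    in subst (IsSquare (r ^ suc (suc (suc e)))) (sym z≡r²z₁) (IsSquare-*-scale r (hensel e {y₁} {z₁} y₁²≋z₁ r^e∤z₁))

  ScaledSquare : ℕ → ℤ → Set
  ScaledSquare k j = IsSquare (r ^ suc k) (+ (r ^ k) * j)

  private
    +r²*-assoc : ∀ k a → + (r ^ suc (suc k)) * a ≡ + r * (+ r * (+ (r ^ k) * a))
    +r²*-assoc k a = trans (cong (_* a) (+r²* (r ^ k))) (reassociate (+ r) (+ (r ^ k)) a)
      where
      reassociate : ∀ r m a → (r * (r * m)) * a ≡ r * (r * (m * a))
      reassociate = solve-∀

  ScaledSquare-+2 : ∀ k j → ScaledSquare (suc (suc k)) j ⇔ ScaledSquare k j
  ScaledSquare-+2 k j = mk⇔ to from
    where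
    X : ℤ
    X = + (r ^ k) * j
    to : ScaledSquare (suc (suc k)) j → ScaledSquare k j
    to (y , y²≋) =
      let r∣y = r∣-square-root {y = y} (ℕ.m∣m*n (r ^ suc (suc k))) y²≋ (∣m⇒∣m*n j (r∣r^suc (suc k)))
          z₁ , r²X≡r²z₁ , z₁-square =
            IsSquare-*-divide r {r ^ suc k} {y} {+ r * (+ r * X)} r∣y (≋-trans y²≋ (≋-reflexive (+r²*-assoc k j)))
          X≡z₁ = *-cancelˡ-≡ (+ r) X z₁ (*-cancelˡ-≡ (+ r) (+ r * X) (+ r * z₁) r²X≡r²z₁)
      in subst (IsSquare (r ^ suc k)) (sym X≡z₁) z₁-square
    from : ScaledSquare k j → ScaledSquare (suc (suc k)) j
    from X-square = subst (IsSquare (r ^ suc (suc (suc k)))) (sym (+r²*-assoc k j)) (IsSquare-*-scale r X-square)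

  ≋-mod-r¹ : ∀ {a b} → a ≋ b [mod r ^ 1 ] ⇔ a ≋ b [mod r ]
  ≋-mod-r¹ = mk⇔ (≋-weaken (ℕ.∣-reflexive (sym (ℕ.*-identityʳ r)))) (≋-weaken (ℕ.∣-reflexive (ℕ.*-identityʳ r)))

  IsSquare-mod-r¹ : ∀ {z} → IsSquare (r ^ 1) z ⇔ IsSquare r z
  IsSquare-mod-r¹ = mk⇔ (λ (y , y²≋z) → y , Equivalence.to ≋-mod-r¹ y²≋z) (λ (y , y²≋z) → y , Equivalence.from ≋-mod-r¹ y²≋z)

  ScaledSquare-0 : ∀ j → ScaledSquare 0 j ⇔ IsSquare r j
  ScaledSquare-0 j = mk⇔ (λ sq → Equivalence.to IsSquare-mod-r¹ (subst (IsSquare (r ^ 1)) (*-identityˡ j) sq))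
                         (λ sq → subst (IsSquare (r ^ 1)) (sym (*-identityˡ j)) (Equivalence.from IsSquare-mod-r¹ sq))

  ScaledSquare-1 : ∀ j → ScaledSquare 1 j ⇔ j ≋ 0ℤ [mod r ]
  ScaledSquare-1 j = mk⇔ to from
    where
    +r¹ : + (r ^ 1) ≡ + r
    +r¹ = cong +_ (ℕ.*-identityʳ r)
    to : ScaledSquare 1 j → j ≋ 0ℤ [mod r ]
    to (y , y²≋) =
      let r∣y = r∣-square-root {y = y} (ℕ.m∣m*n (r ^ 1)) y²≋ (∣m⇒∣m*n j (r∣r^suc 0))
          z₁ , rj≡r²z₁ , _ = IsSquare-*-divide r {1} {y} {+ (r ^ 1) * j} r∣y y²≋
          j≡rz₁ = *-cancelˡ-≡ (+ r) j (+ r * z₁) (trans (cong (_* j) (sym +r¹)) rj≡r²z₁)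
      in ∣⇒≋0 (divides z₁ (trans j≡rz₁ (*-comm (+ r) z₁)))
    from : j ≋ 0ℤ [mod r ] → ScaledSquare 1 j
    from j≋0 with ≋0⇒∣ j≋0
    ... | divides j′ j≡j′r = subst (IsSquare (r ^ 2)) r²j′≡rj (IsSquare-*-scale r (IsSquare-mod-1 j′))
      where
      r²j′≡rj : + r * (+ r * j′) ≡ + (r ^ 1) * j
      r²j′≡rj = trans (cong (+ r *_) (trans (*-comm (+ r) j′) (sym j≡j′r))) (cong (_* j) (sym +r¹))

  ScaledSquare? : ∀ k j → Dec (ScaledSquare k (+ j))
  ScaledSquare? k j = isSquare? (r ^ suc k) {{r^-nonZero (suc k)}} (+ (r ^ k) * + j)

  scaledSquareCount : ℕ → ℕ
  scaledSquareCount k = count (ScaledSquare? k) r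

  scaledSquareCount-0 : 2 ℕ.* scaledSquareCount 0 ≡ r ℕ.+ 1
  scaledSquareCount-0 =
    trans (cong (2 ℕ.*_) (count-cong (ScaledSquare? 0) (λ j → isSquare? r (+ j)) r (λ j _ → ScaledSquare-0 (+ j)))) count-squares

  scaledSquareCount-1 : scaledSquareCount 1 ≡ 1
  scaledSquareCount-1 = trans (count-cong (ScaledSquare? 1) (λ j → + j ≋? 0ℤ [mod r ]) r (λ j _ → ScaledSquare-1 (+ j))) (count-≋0 r)

  scaledSquareCount-+2 : ∀ k → scaledSquareCount (suc (suc k)) ≡ scaledSquareCount k
  scaledSquareCount-+2 k = count-cong (ScaledSquare? (suc (suc k))) (ScaledSquare? k) r (λ j _ → ScaledSquare-+2 k (+ j))

  scaledSquareCount-parity : ∀ k → 2 ℕ.* scaledSquareCount k ℕ.+ 2 ^ (k ℕ.% 2) ℕ.* r ≡ 2 ℕ.* r ℕ.+ 2 ^ (k ℕ.% 2)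
  scaledSquareCount-parity zero = begin
    2 ℕ.* scaledSquareCount 0 ℕ.+ 1 ℕ.* r     ≡⟨ cong (ℕ._+ 1 ℕ.* r) scaledSquareCount-0 ⟩
    r ℕ.+ 1 ℕ.+ 1 ℕ.* r                       ≡⟨ rearrange r ⟩
    2 ℕ.* r ℕ.+ 1                             ∎
    where
    open ≡-Reasoning
    rearrange : ∀ r → r ℕ.+ 1 ℕ.+ 1 ℕ.* r ≡ 2 ℕ.* r ℕ.+ 1
    rearrange = ℕ-solve-∀
  scaledSquareCount-parity (suc zero) = begin
    2 ℕ.* scaledSquareCount 1 ℕ.+ 2 ℕ.* r     ≡⟨ cong (λ n → 2 ℕ.* n ℕ.+ 2 ℕ.* r) scaledSquareCount-1 ⟩
    2 ℕ.+ 2 ℕ.* r                             ≡⟨ ℕ.+-comm 2 (2 ℕ.* r) ⟩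
    2 ℕ.* r ℕ.+ 2                             ∎
    where open ≡-Reasoning
  scaledSquareCount-parity (suc (suc k)) =
    trans (cong (λ n → 2 ℕ.* n ℕ.+ 2 ^ (k ℕ.% 2) ℕ.* r) (scaledSquareCount-+2 k)) (scaledSquareCount-parity k)

module Lifting (r : ℕ) (r-prime : Prime r) (r≢2 : r ≢ 2) (t : ℕ) (t⊥r : Coprime t r) where

  open import Data.Nat as ℕ using (ℕ; zero; suc; NonZero; _^_)
  open import Data.Integer using (ℤ; +_; _+_; _-_; _*_; -_; 0ℤ; 1ℤ; -1ℤ)
  open import Data.Integer.Divisibility.Signed
  open import Relation.Binary.PropositionalEquality
  open import Relation.Nullary using (Dec; ¬_; yes; no)
  import Data.Nat.Properties as ℕ
  import Data.Nat.Divisibility as ℕ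
  open import Data.Integer.Properties using (pos-*; pos-+; *-zeroʳ)
  open import Data.Integer.Tactic.RingSolver using (solve-∀)
  open import Data.Nat.Tactic.RingSolver using () renaming (solve-∀ to ℕ-solve-∀)
  open import Data.Product using (∃-syntax; _,_)
  open import Data.Empty using (⊥-elim)
  open import Function.Bundles using (_⇔_; mk⇔)
  open Counting
  open Congruence
  open Squares
  open OddPrime r r-prime r≢2
  open ≡-Reasoning

  r∤t : ¬ (+ r ∣ + t)
  r∤t r∣t = ℕ.<⇒≢ 1<r (sym (t⊥r (∣⇒∣ᵤ r∣t , ℕ.∣-refl)))

  InS? : ∀ e x → Dec (IsSquare (r ^ e) (+ x * + x - + t))
  InS? e x = isSquare? (r ^ e) {{r^-nonZero e}} (+ x * + x - + t)

  Root? : ∀ e x → Dec (+ x * + x ≋ + t [mod r ^ e ])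
  Root? e x = + x * + x ≋? + t [mod r ^ e ]

  cardS : ℕ → ℕ
  cardS e = count (InS? e) (r ^ e)

  roots : ℕ → ℕ
  roots e = count (Root? e) (r ^ e)

  ≋0? : ∀ w → Dec (w ≋ 0ℤ [mod r ])
  ≋0? w = w ≋? 0ℤ [mod r ]

  root-mod-r⇒r∤ : ∀ {a} → a * a ≋ + t [mod r ] → ¬ (+ r ∣ a)
  root-mod-r⇒r∤ {a} a²≋t r∣a = r∤t (≋0⇒∣ (≋-trans (≋-sym a²≋t) (∣⇒≋0 (∣m⇒∣m*n a r∣a))))

  module Lift (e : ℕ) where

    m : ℕ
    m = r ^ suc e

    instance
      m-nonZero : NonZero m
      m-nonZero = r^-nonZero (suc e)

    lift : ℕ → ℕ → ℕ
    lift k a = k ℕ.* m ℕ.+ a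

    +lift : ∀ k a → + lift k a ≡ + k * + m + + a
    +lift k a = trans (pos-+ (k ℕ.* m) a) (cong (_+ + a) (pos-* k m))

    lift≋ : ∀ k a → + lift k a ≋ + a [mod m ]
    lift≋ k a = ≋-trans (≋-reflexive (trans (+lift k a) (swap (+ k * + m) (+ a)))) (a+q*m≋a (+ a) (+ k))
      where
      swap : ∀ x y → x + y ≡ y + x
      swap = solve-∀

    lift-expansion : ∀ k a c → + a * + a - + t ≡ c * + m →
                     + lift k a * + lift k a - + t ≋ + m * (c + (+ 2 * + a) * + k) [mod r ℕ.* m ]
    lift-expansion k a c a²-t≡cm = mk≋ (divides (+ k * + k * + (r ^ e)) (begin
      + lift k a * + lift k a - + t - M * (c + (+ 2 * + a) * + k)
        ≡⟨ cong (λ x → x * x - + t - M * (c + (+ 2 * + a) * + k)) (+lift k a) ⟩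
      (+ k * M + + a) * (+ k * M + + a) - + t - M * (c + (+ 2 * + a) * + k)
        ≡⟨ expand (+ k) M (+ a) (+ t) c ⟩
      (+ a * + a - + t) - c * M + + k * + k * (M * M)
        ≡⟨ cong (λ x → x - c * M + + k * + k * (M * M)) a²-t≡cm ⟩
      c * M - c * M + + k * + k * (M * M)
        ≡⟨ cancel (c * M) (+ k * + k * (M * M)) ⟩
      + k * + k * (M * M)
        ≡⟨ cong (λ x → + k * + k * (x * M)) (pos-* r (r ^ e)) ⟩
      + k * + k * ((+ r * + (r ^ e)) * M)
        ≡⟨ regroup (+ k) (+ r) (+ (r ^ e)) M ⟩
      + k * + k * + (r ^ e) * (+ r * M)
        ≡⟨ cong (+ k * + k * + (r ^ e) *_) (pos-* r m) ⟨
      + k * + k * + (r ^ e) * + (r ℕ.* m)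
        ∎))
      where
      M : ℤ
      M = + m
      expand : ∀ k M a t c → (k * M + a) * (k * M + a) - t - M * (c + (+ 2 * a) * k) ≡ (a * a - t) - c * M + k * k * (M * M)
      expand = solve-∀
      cancel : ∀ x y → x - x + y ≡ y
      cancel = solve-∀
      regroup : ∀ k r R M → k * k * ((r * R) * M) ≡ k * k * R * (r * M)
      regroup = solve-∀

    LiftInS? : ∀ a k → Dec (IsSquare (r ℕ.* m) (+ lift k a * + lift k a - + t))
    LiftInS? a k = InS? (suc (suc e)) (lift k a)

    LiftRoot? : ∀ a k → Dec (+ lift k a * + lift k a ≋ + t [mod r ℕ.* m ])
    LiftRoot? a k = Root? (suc (suc e)) (lift k a)

    lift-square≋ : ∀ k a → + lift k a * + lift k a - + t ≋ + a * + a - + t [mod m ]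
    lift-square≋ k a = ≋-+-cong (≋-*-cong (lift≋ k a) (lift≋ k a)) (≋-refl {a = - + t})

    m-scale≋ : ∀ {a b} → a ≋ b [mod r ] → + m * a ≋ + m * b [mod r ℕ.* m ]
    m-scale≋ a≋b = ≋-weaken (ℕ.∣-reflexive (ℕ.*-comm r m)) (≋-*-scale m a≋b)

    m-cancel≋ : ∀ {a b} → + m * a ≋ + m * b [mod r ℕ.* m ] → a ≋ b [mod r ]
    m-cancel≋ ma≋mb = ≋-*-cancel m (≋-weaken (ℕ.∣-reflexive (ℕ.*-comm m r)) ma≋mb)

    root-coefficient-invertible : ∀ a c → + a * + a - + t ≡ c * + m → ∃[ v ] (+ 2 * + a) * v ≋ 1ℤ [mod r ]
    root-coefficient-invertible a c a²-t≡cm = invertible {+ 2 * + a} (r∤* {+ 2} {+ a} r∤2 (root-mod-r⇒r∤ {+ a} a²≋t))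
      where
      a²≋t : + a * + a ≋ + t [mod r ]
      a²≋t = ≋-weaken (ℕ.m∣m*n (r ^ e)) (mk≋ (divides c a²-t≡cm))

    lifts-of-root : ∀ a c → + a * + a - + t ≡ c * + m → count (LiftInS? a) r ≡ scaledSquareCount (suc e)
    lifts-of-root a c a²-t≡cm =
      let v , 2av≋1 = root-coefficient-invertible a c a²-t≡cm
      in trans (count-cong (LiftInS? a) (λ k → MSquare? (c + (+ 2 * + a) * + k)) r (λ k _ → lift-in-S⇔ k))
               (count-affine r MSquare? (λ w≋w′ → IsSquare-resp-≋ (m-scale≋ w≋w′)) c (+ 2 * + a) v 2av≋1)
      where
      lift-in-S⇔ : ∀ k → IsSquare (r ℕ.* m) (+ lift k a * + lift k a - + t) ⇔ IsSquare (r ℕ.* m) (+ m * (c + (+ 2 * + a) * + k))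
      lift-in-S⇔ k = mk⇔ (IsSquare-resp-≋ (lift-expansion k a c a²-t≡cm)) (IsSquare-resp-≋ (≋-sym (lift-expansion k a c a²-t≡cm)))
      MSquare? : ∀ w → Dec (IsSquare (r ℕ.* m) (+ m * w))
      MSquare? w = isSquare? (r ℕ.* m) {{r^-nonZero (suc (suc e))}} (+ m * w)

    lifts-of-nonroot : ∀ a → IsSquare m (+ a * + a - + t) → ¬ (+ a * + a ≋ + t [mod m ]) → count (LiftInS? a) r ≡ r
    lifts-of-nonroot a (y , y²≋) a²≉t = count-all (LiftInS? a) r (λ k _ →
      hensel (suc e) {y} {+ lift k a * + lift k a - + t} (≋-trans y²≋ (≋-sym (lift-square≋ k a)))
        (λ m∣ → a²≉t (mk≋ (≋0⇒∣ (≋-trans (≋-sym (lift-square≋ k a)) (∣⇒≋0 m∣))))))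

    lifts-of-nonsquare : ∀ a → ¬ IsSquare m (+ a * + a - + t) → count (LiftInS? a) r ≡ 0
    lifts-of-nonsquare a ¬sq = count-none (LiftInS? a) r (λ k _ sq →
      ¬sq (IsSquare-resp-≋ (lift-square≋ k a) (IsSquare-weaken (ℕ.n∣m*n r) sq)))

    -- Of the r lifts of a, all lie in 𝒮 modulo r m if a ∈ 𝒮 is not a root (Hensel), scaledSquareCount (suc e)
    -- do if a is a root, and none if a ∉ 𝒮; stated additively, to avoid truncated subtraction.
    lifts-per-residue : ∀ a → count (LiftInS? a) r ℕ.+ 𝟙 (Root? (suc e) a) ℕ.* r
                            ≡ r ℕ.* 𝟙 (InS? (suc e) a) ℕ.+ 𝟙 (Root? (suc e) a) ℕ.* scaledSquareCount (suc e)
    lifts-per-residue a with InS? (suc e) a | Root? (suc e) a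
    ... | yes _  | yes (mk≋ (divides c a²-t≡cm)) =
      trans (cong (ℕ._+ 1 ℕ.* r) (lifts-of-root a c a²-t≡cm)) (rearrange (scaledSquareCount (suc e)) r)
      where
      rearrange : ∀ p r → p ℕ.+ 1 ℕ.* r ≡ r ℕ.* 1 ℕ.+ 1 ℕ.* p
      rearrange = ℕ-solve-∀
    ... | yes sq | no a²≉t = cong (ℕ._+ 0) (trans (lifts-of-nonroot a sq a²≉t) (sym (ℕ.*-identityʳ r)))
    ... | no ¬sq | yes a²≋t = ⊥-elim (¬sq (0ℤ , ≋-sym (∣⇒≋0 (≋⇒∣ a²≋t))))
    ... | no ¬sq | no _     = cong (ℕ._+ 0) (trans (lifts-of-nonsquare a ¬sq) (sym (ℕ.*-zeroʳ r)))

    root-lifts : ∀ a → count (LiftRoot? a) r ≡ 𝟙 (Root? (suc e) a)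
    root-lifts a with Root? (suc e) a
    ... | yes (mk≋ (divides c a²-t≡cm)) =
      let v , 2av≋1 = root-coefficient-invertible a c a²-t≡cm
      in begin
        count (LiftRoot? a) r
          ≡⟨ count-cong (LiftRoot? a) (λ k → ≋0? (c + (+ 2 * + a) * + k)) r (λ k _ → lift-is-root⇔ k) ⟩
        count (λ k → ≋0? (c + (+ 2 * + a) * + k)) r
          ≡⟨ count-affine r ≋0? (λ w≋w′ w≋0 → ≋-trans (≋-sym w≋w′) w≋0) c (+ 2 * + a) v 2av≋1 ⟩
        count (λ k → ≋0? (+ k)) r
          ≡⟨ count-≋0 r ⟩
        1
          ∎
      where
      lift-is-root⇔ : ∀ k → + lift k a * + lift k a ≋ + t [mod r ℕ.* m ] ⇔ c + (+ 2 * + a) * + k ≋ 0ℤ [mod r ]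
      lift-is-root⇔ k = mk⇔
        (λ L²≋t → m-cancel≋ {c + (+ 2 * + a) * + k} {0ℤ}
           (≋-trans (≋-sym (lift-expansion k a c a²-t≡cm)) (≋-trans (∣⇒≋0 (≋⇒∣ L²≋t)) (≋-reflexive (sym (*-zeroʳ (+ m)))))))
        (λ w≋0 → mk≋ (≋0⇒∣ (≋-trans (lift-expansion k a c a²-t≡cm) (≋-trans (m-scale≋ w≋0) (≋-reflexive (*-zeroʳ (+ m)))))))
    ... | no a²≉t = count-none (LiftRoot? a) r (λ k _ L²≋t →
      a²≉t (≋-trans (≋-sym (≋-*-cong (lift≋ k a) (lift≋ k a))) (≋-weaken (ℕ.n∣m*n r) L²≋t)))

    cardS-step : cardS (suc (suc e)) ℕ.+ roots (suc e) ℕ.* r ≡ r ℕ.* cardS (suc e) ℕ.+ roots (suc e) ℕ.* scaledSquareCount (suc e)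
    cardS-step = begin
      cardS (suc (suc e)) ℕ.+ roots (suc e) ℕ.* r
        ≡⟨ cong₂ ℕ._+_ (count-* (InS? (suc (suc e))) r m) (sym (∑<-distribʳ-* m r _)) ⟩
      ∑< m (λ a → count (LiftInS? a) r) ℕ.+ ∑< m (λ a → 𝟙 (Root? (suc e) a) ℕ.* r)
        ≡⟨ ∑<-distrib-+ m _ _ ⟨
      ∑< m (λ a → count (LiftInS? a) r ℕ.+ 𝟙 (Root? (suc e) a) ℕ.* r)
        ≡⟨ ∑<-cong m (λ a _ → lifts-per-residue a) ⟩
      ∑< m (λ a → r ℕ.* 𝟙 (InS? (suc e) a) ℕ.+ 𝟙 (Root? (suc e) a) ℕ.* P)
        ≡⟨ ∑<-distrib-+ m _ _ ⟩
      ∑< m (λ a → r ℕ.* 𝟙 (InS? (suc e) a)) ℕ.+ ∑< m (λ a → 𝟙 (Root? (suc e) a) ℕ.* P)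
        ≡⟨ cong₂ ℕ._+_ (∑<-distribˡ-* m r _) (∑<-distribʳ-* m P _) ⟩
      r ℕ.* cardS (suc e) ℕ.+ roots (suc e) ℕ.* P
        ∎
      where
      P : ℕ
      P = scaledSquareCount (suc e)

    roots-step : roots (suc (suc e)) ≡ roots (suc e)
    roots-step = trans (count-* (Root? (suc (suc e))) r m) (∑<-cong m (λ a _ → root-lifts a))

  private
    RootMod-r? : ∀ y → Dec (+ y * + y ≋ + t [mod r ])
    RootMod-r? y = + y * + y ≋? + t [mod r ]

    roots-mod-r : count RootMod-r? r ≡ 2 ℕ.* 𝟙 (isSquare? r (+ t))
    roots-mod-r = begin
      count RootMod-r? r
        ≡⟨ ℕ.+-identityʳ _ ⟨
      count RootMod-r? r ℕ.+ 0
        ≡⟨ cong (count RootMod-r? r ℕ.+_) (𝟙-no (+ t ≋? 0ℤ [mod r ]) (λ t≋0 → r∤t (≋0⇒∣ t≋0))) ⟨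
      count RootMod-r? r ℕ.+ 𝟙 (+ t ≋? 0ℤ [mod r ])
        ≡⟨ square-roots (+ t) ⟩
      2 ℕ.* 𝟙 (isSquare? r (+ t))
        ∎

  roots-constant : ∀ e → roots (suc e) ≡ 2 ℕ.* 𝟙 (isSquare? r (+ t))
  roots-constant zero = begin
    count (Root? 1) (r ^ 1)     ≡⟨ cong (count (Root? 1)) (ℕ.*-identityʳ r) ⟩
    count (Root? 1) r           ≡⟨ count-cong (Root? 1) RootMod-r? r (λ _ _ → ≋-mod-r¹) ⟩
    count RootMod-r? r          ≡⟨ roots-mod-r ⟩
    2 ℕ.* 𝟙 (isSquare? r (+ t)) ∎
  roots-constant (suc e) = trans (Lift.roots-step e) (roots-constant e)

  -- 2 |𝒮₁| counts the pairs (x , y) with y² ≡ x² − t plus the roots of x² ≡ t. Substituting y = x − u,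
  -- the pair condition becomes 2ux ≡ u² + t, which has exactly one solution x for each u ≢ 0 and none for u = 0.
  private
    Pair? : ∀ x w → Dec (w * w ≋ + x * + x - + t [mod r ])
    Pair? x w = w * w ≋? + x * + x - + t [mod r ]

    Square? : ∀ x → Dec (IsSquare r (+ x * + x - + t))
    Square? x = isSquare? r (+ x * + x - + t)

    pairs-with-difference : ℕ → ℕ
    pairs-with-difference u = count (λ x → Pair? x (+ x + -1ℤ * + u)) r

    pairs-with-difference-0 : pairs-with-difference 0 ≡ 0
    pairs-with-difference-0 = count-none (λ x → Pair? x (+ x + -1ℤ * + 0)) r (λ x _ pair →
      r∤t (subst (+ r ∣_) (difference (+ x) (+ t)) (≋⇒∣ pair)))
      where
      difference : ∀ x t → (x + -1ℤ * + 0) * (x + -1ℤ * + 0) - (x * x - t) ≡ t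
      difference = solve-∀

    pairs-with-difference-suc : ∀ u → suc u ℕ.< r → pairs-with-difference (suc u) ≡ 1
    pairs-with-difference-suc u 1+u<r =
      let v , 2uv≋1 = invertible {+ 2 * U} (r∤* {+ 2} {U} r∤2 r∤U)
      in begin
        count (λ x → Pair? x (+ x + -1ℤ * U)) r
          ≡⟨ count-cong (λ x → Pair? x (+ x + -1ℤ * U)) (λ x → ≋0? (c + (+ 2 * U) * + x)) r (λ x _ → pair⇔ x) ⟩
        count (λ x → ≋0? (c + (+ 2 * U) * + x)) r
          ≡⟨ count-affine r ≋0? (λ w≋w′ w≋0 → ≋-trans (≋-sym w≋w′) w≋0) c (+ 2 * U) v 2uv≋1 ⟩
        count (λ x → ≋0? (+ x)) r
          ≡⟨ count-≋0 r ⟩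
        1
          ∎
      where
      U : ℤ
      U = + suc u
      c : ℤ
      c = - (+ t + U * U)
      r∤U : ¬ (+ r ∣ U)
      r∤U r∣U with residue-unique 1+u<r 0<r (∣⇒≋0 r∣U)
      ... | ()
      difference : ∀ x t U → (x * x - t) - (x + -1ℤ * U) * (x + -1ℤ * U) ≡ - (t + U * U) + (+ 2 * U) * x
      difference = solve-∀
      pair⇔ : ∀ x → (+ x + -1ℤ * U) * (+ x + -1ℤ * U) ≋ + x * + x - + t [mod r ] ⇔ c + (+ 2 * U) * + x ≋ 0ℤ [mod r ]
      pair⇔ x = mk⇔ (λ pair → ∣⇒≋0 (subst (+ r ∣_) (difference (+ x) (+ t) U) (≋⇒∣ (≋-sym pair))))
                    (λ c+2Ux≋0 → ≋-sym (mk≋ (subst (+ r ∣_) (sym (difference (+ x) (+ t) U)) (≋0⇒∣ c+2Ux≋0))))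

    pairs+1 : ∑< r (λ x → count (λ y → Pair? x (+ y)) r) ℕ.+ 1 ≡ r
    pairs+1 = begin
      ∑< r (λ x → count (λ y → Pair? x (+ y)) r) ℕ.+ 1
        ≡⟨ cong (ℕ._+ 1) (∑<-cong r (λ x _ → substitute x)) ⟨
      ∑< r (λ x → count (λ u → Pair? x (+ x + -1ℤ * + u)) r) ℕ.+ 1
        ≡⟨ cong (ℕ._+ 1) (∑<-comm r r _) ⟩
      ∑< r pairs-with-difference ℕ.+ 1
        ≡⟨ cong (λ n → ∑< n pairs-with-difference ℕ.+ 1) (ℕ.suc-pred r) ⟨
      ∑< (suc r′) pairs-with-difference ℕ.+ 1
        ≡⟨ cong (ℕ._+ 1) (∑<-suc r′ pairs-with-difference) ⟩
      pairs-with-difference 0 ℕ.+ ∑< r′ (λ u → pairs-with-difference (suc u)) ℕ.+ 1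
        ≡⟨ cong₂ (λ a b → a ℕ.+ b ℕ.+ 1) pairs-with-difference-0 nonzero-differences ⟩
      r′ ℕ.+ 1
        ≡⟨ ℕ.+-comm r′ 1 ⟩
      suc r′
        ≡⟨ ℕ.suc-pred r ⟩
      r
        ∎
      where
      r′ : ℕ
      r′ = ℕ.pred r
      substitute : ∀ x → count (λ u → Pair? x (+ x + -1ℤ * + u)) r ≡ count (λ y → Pair? x (+ y)) r
      substitute x = count-affine r (Pair? x) (λ w≋w′ pair → ≋-trans (≋-*-cong (≋-sym w≋w′) (≋-sym w≋w′)) pair)
                                  (+ x) -1ℤ -1ℤ ≋-refl
      nonzero-differences : ∑< r′ (λ u → pairs-with-difference (suc u)) ≡ r′
      nonzero-differences = trans (∑<-cong r′ (λ u u<r′ → pairs-with-difference-suc u (1+u<r u<r′)))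
                                  (trans (∑<-const r′ 1) (ℕ.*-identityʳ r′))
        where
        1+u<r : ∀ {u} → u ℕ.< r′ → suc u ℕ.< r
        1+u<r u<r′ = ℕ.<-≤-trans (ℕ.s≤s u<r′) (ℕ.≤-reflexive (ℕ.suc-pred r))

  cardS-one : 2 ℕ.* cardS 1 ℕ.+ 1 ≡ r ℕ.+ 2 ℕ.* 𝟙 (isSquare? r (+ t))
  cardS-one = begin
    2 ℕ.* cardS 1 ℕ.+ 1
      ≡⟨ cong (λ n → 2 ℕ.* n ℕ.+ 1) cardS-one-mod-r ⟩
    2 ℕ.* count Square? r ℕ.+ 1
      ≡⟨ cong (ℕ._+ 1) (∑<-distribˡ-* r 2 _) ⟨
    ∑< r (λ x → 2 ℕ.* 𝟙 (Square? x)) ℕ.+ 1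
      ≡⟨ cong (ℕ._+ 1) (∑<-cong r (λ x _ → square-roots (+ x * + x - + t))) ⟨
    ∑< r (λ x → count (λ y → Pair? x (+ y)) r ℕ.+ 𝟙 (≋0? (+ x * + x - + t))) ℕ.+ 1
      ≡⟨ cong (ℕ._+ 1) (∑<-distrib-+ r _ _) ⟩
    N ℕ.+ count (λ x → ≋0? (+ x * + x - + t)) r ℕ.+ 1
      ≡⟨ cong (λ n → N ℕ.+ n ℕ.+ 1) (trans (count-cong _ RootMod-r? r (λ _ _ → -≋0⇔≋)) roots-mod-r) ⟩
    N ℕ.+ R ℕ.+ 1
      ≡⟨ rearrange N R ⟩
    N ℕ.+ 1 ℕ.+ R
      ≡⟨ cong (ℕ._+ R) pairs+1 ⟩
    r ℕ.+ R
      ∎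
    where
    N : ℕ
    N = ∑< r (λ x → count (λ y → Pair? x (+ y)) r)
    R : ℕ
    R = 2 ℕ.* 𝟙 (isSquare? r (+ t))
    cardS-one-mod-r : cardS 1 ≡ count Square? r
    cardS-one-mod-r = trans (cong (count (InS? 1)) (ℕ.*-identityʳ r)) (count-cong (InS? 1) Square? r (λ _ _ → IsSquare-mod-r¹))
    rearrange : ∀ n k → n ℕ.+ k ℕ.+ 1 ≡ n ℕ.+ 1 ℕ.+ k
    rearrange = ℕ-solve-∀

open import Defs
open import Data.Nat as ℕ using (ℕ; _^_; _<_; _≤_; _%_)
open import Data.Nat.Primality using (Prime)
open import Data.Nat.Coprimality using (Coprime)
open import Data.Integer using (ℤ; +_; _+_; _-_; _*_; _/_; 1ℤ; -1ℤ)
open import Relation.Binary.PropositionalEquality using (_≡_; _≢_)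
open import Data.Product using (_×_)

open import Data.Nat using (suc; z≤n; s≤s)
import Data.Nat.Properties as ℕ
import Data.Nat.Divisibility as ℕ
import Data.Nat.DivMod as ℕ
open import Data.Nat.Tactic.RingSolver using () renaming (solve-∀ to ℕ-solve-∀)
open import Data.Integer using (0ℤ)
open import Data.Integer.Properties using (pos-+; pos-*; *-identityˡ; +-assoc; +-injective)
open import Data.Integer.Tactic.RingSolver using (solve-∀)
open import Data.Product using (_,_)
open import Data.Empty using (⊥-elim)
open import Function.Bundles using (_⇔_; mk⇔; Equivalence)
open import Relation.Binary.PropositionalEquality using (refl; sym; trans; cong; subst; module ≡-Reasoning)
open import Relation.Nullary using (¬_; yes; no)
open Counting
open Congruence
open Squares

legendre-of-square : ∀ {a p} → ¬ (a ≡ 0ℤ [mod p ]) → IsSquareMod p a → legendre a p ≡ 1ℤ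
legendre-of-square {a} {p} a≢0 sq with a ≡? 0ℤ [mod p ]
... | yes a≡0 = ⊥-elim (a≢0 a≡0)
... | no _ with isSquareMod? p a
...   | yes _  = refl
...   | no ¬sq = ⊥-elim (¬sq sq)

legendre-of-nonsquare : ∀ {a p} → ¬ (a ≡ 0ℤ [mod p ]) → ¬ IsSquareMod p a → legendre a p ≡ -1ℤ
legendre-of-nonsquare {a} {p} a≢0 ¬sq with a ≡? 0ℤ [mod p ]
... | yes a≡0 = ⊥-elim (a≢0 a≡0)
... | no _ with isSquareMod? p a
...   | yes sq = ⊥-elim (¬sq sq)
...   | no _   = refl

halve : ∀ c → + (c ℕ.* 2) / + 2 ≡ + c
halve c = trans (*-identityˡ _) (cong +_ (ℕ.m*n/n≡m c 2))

private
  +n-1≡z⇒+n≡z+1 : ∀ {n z} → + n - 1ℤ ≡ z → + n ≡ z + 1ℤ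
  +n-1≡z⇒+n≡z+1 {n} refl = add-back (+ n)
    where
    add-back : ∀ x → x ≡ x - 1ℤ + 1ℤ
    add-back = solve-∀

residue-recurrence : ∀ a b r p k → a ℕ.+ 2 ℕ.* r ≡ r ℕ.* b ℕ.+ 2 ℕ.* p → 2 ℕ.* p ℕ.+ k ℕ.* r ≡ 2 ℕ.* r ℕ.+ k →
                     + a ≡ + b * + r - + k * (+ r - 1ℤ)
residue-recurrence a b r p k step parity = begin
  + a                                      ≡⟨ isolate (+ a) (+ k * + r) (+ r * + b + + k) ℤ-form ⟩
  + r * + b + + k - + k * + r              ≡⟨ regroup (+ b) (+ r) (+ k) ⟩
  + b * + r - + k * (+ r - 1ℤ)             ∎
  where
  open ≡-Reasoning
  ℕ-form : a ℕ.+ k ℕ.* r ≡ r ℕ.* b ℕ.+ k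
  ℕ-form = ℕ.+-cancelʳ-≡ (2 ℕ.* r) _ _ (begin
    a ℕ.+ k ℕ.* r ℕ.+ 2 ℕ.* r                 ≡⟨ swap a (k ℕ.* r) (2 ℕ.* r) ⟩
    a ℕ.+ 2 ℕ.* r ℕ.+ k ℕ.* r                 ≡⟨ cong (ℕ._+ k ℕ.* r) step ⟩
    r ℕ.* b ℕ.+ 2 ℕ.* p ℕ.+ k ℕ.* r           ≡⟨ ℕ.+-assoc (r ℕ.* b) (2 ℕ.* p) (k ℕ.* r) ⟩
    r ℕ.* b ℕ.+ (2 ℕ.* p ℕ.+ k ℕ.* r)         ≡⟨ cong (r ℕ.* b ℕ.+_) parity ⟩
    r ℕ.* b ℕ.+ (2 ℕ.* r ℕ.+ k)               ≡⟨ swap′ (r ℕ.* b) (2 ℕ.* r) k ⟩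
    r ℕ.* b ℕ.+ k ℕ.+ 2 ℕ.* r                 ∎)
    where
    swap : ∀ x y z → x ℕ.+ y ℕ.+ z ≡ x ℕ.+ z ℕ.+ y
    swap = ℕ-solve-∀
    swap′ : ∀ x y z → x ℕ.+ (y ℕ.+ z) ≡ x ℕ.+ z ℕ.+ y
    swap′ = ℕ-solve-∀
  ℤ-form : + a + + k * + r ≡ + r * + b + + k
  ℤ-form = trans (cong (λ x → + a + x) (sym (pos-* k r))) (trans (sym (pos-+ a (k ℕ.* r)))
             (trans (cong +_ ℕ-form) (trans (pos-+ (r ℕ.* b) k) (cong (_+ + k) (pos-* r b)))))
  isolate : ∀ x y z → x + y ≡ z → x ≡ z - y
  isolate x y .(x + y) refl = cancel x y
    where
    cancel : ∀ x y → x ≡ x + y - y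
    cancel = solve-∀
  regroup : ∀ b r k → r * b + k - k * r ≡ b * r - k * (r - 1ℤ)
  regroup = solve-∀

module Corollary (t e r : ℕ) (r-prime : Prime r) (r≢2 : r ≢ 2) (t⊥r : Coprime t r) (tbar : ℕ)
                 (4tbar≡t : (+ 4 * + tbar) ≡ + t [mod r ^ suc e ]) where

  open OddPrime r r-prime r≢2

  open Lifting r r-prime r≢2 t t⊥r

  card-S≡cardS : ∀ e → card-S t r e ≡ cardS e
  card-S≡cardS e = trans (length-filter-upTo (inS? t r e) (r ^ e))
    (count-cong (inS? t r e) (InS? e) (r ^ e) (λ _ _ → mk⇔ IsSquareMod⇒IsSquare (IsSquare⇒IsSquareMod {{r^-nonZero e}})))

  4tbar≋t : + 4 * + tbar ≋ + t [mod r ]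
  4tbar≋t = ≋-weaken (ℕ.m∣m*n (r ^ e)) (≡mod⇒≋ 4tbar≡t)

  tbar-square⇔t-square : IsSquare r (+ tbar) ⇔ IsSquare r (+ t)
  tbar-square⇔t-square = mk⇔
    (λ sq → IsSquare-resp-≋ 4tbar≋t (IsSquare-*-square (+ 2) sq))
    (λ sq → let v , 2v≋1 = invertible {+ 2} r∤2 in IsSquare-resp-≋ (v²t≋tbar v 2v≋1) (IsSquare-*-square v sq))
    where
    v²t≋tbar : ∀ v → + 2 * v ≋ 1ℤ [mod r ] → v * v * + t ≋ + tbar [mod r ]
    v²t≋tbar v 2v≋1 = begin
      v * v * + t                      ≈⟨ ≋-*-congˡ (v * v) (≋-sym 4tbar≋t) ⟩
      v * v * (+ 4 * + tbar)           ≡⟨ regroup v (+ tbar) ⟩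
      (+ 2 * v) * (+ 2 * v) * + tbar   ≈⟨ ≋-*-cong (≋-*-cong 2v≋1 2v≋1) ≋-refl ⟩
      1ℤ * 1ℤ * + tbar                 ≡⟨ *-identityˡ (+ tbar) ⟩
      + tbar                           ∎
      where
      open ≋-Reasoning r
      regroup : ∀ v b → v * v * (+ 4 * b) ≡ (+ 2 * v) * (+ 2 * v) * b
      regroup = solve-∀

  tbar≢0 : ¬ ((+ tbar) ≡ 0ℤ [mod r ])
  tbar≢0 tbar≡0 = r∤t (≋0⇒∣ (≋-trans (≋-sym 4tbar≋t) (≋-*-congˡ (+ 4) (≡mod⇒≋ {+ tbar} {0ℤ} {r} tbar≡0))))

  legendre-tbar : legendre (+ tbar) r ≡ + (2 ℕ.* 𝟙 (isSquare? r (+ t))) - 1ℤ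
  legendre-tbar with isSquare? r (+ t)
  ... | yes sq = legendre-of-square tbar≢0 (IsSquare⇒IsSquareMod (Equivalence.from tbar-square⇔t-square sq))
  ... | no ¬sq = legendre-of-nonsquare tbar≢0 (λ sq → ¬sq (Equivalence.to tbar-square⇔t-square (IsSquareMod⇒IsSquare sq)))

  card-S-one : + card-S t r 1 ≡ (+ r + legendre (+ tbar) r) / + 2
  card-S-one = begin
    + card-S t r 1                               ≡⟨ cong +_ (card-S≡cardS 1) ⟩
    + cardS 1                                    ≡⟨ halve (cardS 1) ⟨
    + (cardS 1 ℕ.* 2) / + 2                      ≡⟨ cong (_/ + 2) twice-cardS-one ⟩
    (+ r + legendre (+ tbar) r) / + 2            ∎
    where
    open ≡-Reasoning
    twice-cardS-one : + (cardS 1 ℕ.* 2) ≡ + r + legendre (+ tbar) r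
    twice-cardS-one = begin
      + (cardS 1 ℕ.* 2)
        ≡⟨ cong +_ (ℕ.*-comm (cardS 1) 2) ⟩
      + (2 ℕ.* cardS 1)
        ≡⟨ add-back (+ (2 ℕ.* cardS 1)) ⟩
      + (2 ℕ.* cardS 1) + + 1 - 1ℤ
        ≡⟨ cong (_- 1ℤ) (trans (sym (pos-+ (2 ℕ.* cardS 1) 1)) (cong +_ cardS-one)) ⟩
      + (r ℕ.+ 2 ℕ.* 𝟙 (isSquare? r (+ t))) - 1ℤ
        ≡⟨ cong (_- 1ℤ) (pos-+ r (2 ℕ.* 𝟙 (isSquare? r (+ t)))) ⟩
      + r + + (2 ℕ.* 𝟙 (isSquare? r (+ t))) - 1ℤ
        ≡⟨ +-assoc (+ r) (+ (2 ℕ.* 𝟙 (isSquare? r (+ t)))) -1ℤ ⟩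
      + r + (+ (2 ℕ.* 𝟙 (isSquare? r (+ t))) - 1ℤ)
        ≡⟨ cong (λ x → + r + x) legendre-tbar ⟨
      + r + legendre (+ tbar) r
        ∎
      where
      add-back : ∀ x → x ≡ x + + 1 - 1ℤ
      add-back = solve-∀

  roots-nonresidue : legendre (+ tbar) r ≡ -1ℤ → roots (suc e) ≡ 0
  roots-nonresidue ℓ≡-1 = trans (roots-constant e) (+-injective (+n-1≡z⇒+n≡z+1 (trans (sym legendre-tbar) ℓ≡-1)))

  roots-residue : legendre (+ tbar) r ≡ 1ℤ → roots (suc e) ≡ 2
  roots-residue ℓ≡1 = trans (roots-constant e) (+-injective (+n-1≡z⇒+n≡z+1 (trans (sym legendre-tbar) ℓ≡1)))

  cardS-step-with : ∀ {n} → roots (suc e) ≡ n →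
                    cardS (suc (suc e)) ℕ.+ n ℕ.* r ≡ r ℕ.* cardS (suc e) ℕ.+ n ℕ.* scaledSquareCount (suc e)
  cardS-step-with {n} refl = Lift.cardS-step e

  card-S-nonresidue : legendre (+ tbar) r ≡ -1ℤ → + card-S t r (suc (suc e)) ≡ + card-S t r (suc e) * + r
  card-S-nonresidue ℓ≡-1 = begin
    + card-S t r (suc (suc e))                    ≡⟨ cong +_ (card-S≡cardS (suc (suc e))) ⟩
    + cardS (suc (suc e))                         ≡⟨ cong +_ cardS-rec ⟩
    + (cardS (suc e) ℕ.* r)                       ≡⟨ pos-* (cardS (suc e)) r ⟩
    + cardS (suc e) * + r                         ≡⟨ cong (λ n → + n * + r) (card-S≡cardS (suc e)) ⟨
    + card-S t r (suc e) * + r                    ∎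
    where
    open ≡-Reasoning
    cardS-rec : cardS (suc (suc e)) ≡ cardS (suc e) ℕ.* r
    cardS-rec = begin
      cardS (suc (suc e))            ≡⟨ ℕ.+-identityʳ _ ⟨
      cardS (suc (suc e)) ℕ.+ 0      ≡⟨ cardS-step-with (roots-nonresidue ℓ≡-1) ⟩
      r ℕ.* cardS (suc e) ℕ.+ 0      ≡⟨ ℕ.+-identityʳ _ ⟩
      r ℕ.* cardS (suc e)            ≡⟨ ℕ.*-comm r _ ⟩
      cardS (suc e) ℕ.* r            ∎

  card-S-residue : legendre (+ tbar) r ≡ 1ℤ →
                   + card-S t r (suc (suc e)) ≡ + card-S t r (suc e) * + r - + (2 ^ (suc e % 2)) * (+ r - 1ℤ)
  card-S-residue ℓ≡1 = begin
    + card-S t r (suc (suc e))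
      ≡⟨ cong +_ (card-S≡cardS (suc (suc e))) ⟩
    + cardS (suc (suc e))
      ≡⟨ residue-recurrence (cardS (suc (suc e))) (cardS (suc e)) r (scaledSquareCount (suc e)) (2 ^ (suc e % 2))
                            (cardS-step-with (roots-residue ℓ≡1)) (scaledSquareCount-parity (suc e)) ⟩
    + cardS (suc e) * + r - + (2 ^ (suc e % 2)) * (+ r - 1ℤ)
      ≡⟨ cong (λ n → + n * + r - + (2 ^ (suc e % 2)) * (+ r - 1ℤ)) (card-S≡cardS (suc e)) ⟨
    + card-S t r (suc e) * + r - + (2 ^ (suc e % 2)) * (+ r - 1ℤ)
      ∎
    where open ≡-Reasoning

corollary7p4 : (t e r : ℕ) → 1 ≤ e → Prime r → r ≢ 2 → Coprime t r →
    (tbar : ℕ) → tbar < r ^ e → (+ 4 * + tbar) ≡ + t [mod r ^ e ] →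
    ((+ card-S t r 1) ≡ (+ r + legendre (+ tbar) r) / + 2)
    × (legendre (+ tbar) r ≡ -1ℤ → + card-S t r (ℕ.suc e) ≡ + card-S t r e * + r)
    × (legendre (+ tbar) r ≡ 1ℤ →
        + card-S t r (ℕ.suc e) ≡ + card-S t r e * + r - + (2 ^ (e % 2)) * (+ r - 1ℤ))
corollary7p4 t (suc e) r (s≤s z≤n) r-prime r≢2 t⊥r tbar _ 4tbar≡t = card-S-one , card-S-nonresidue , card-S-residue
  where open Corollary t e r r-prime r≢2 t⊥r tbar 4tbar≡t
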